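{- Let $T$ be a strong monad on $\mathbb{C}$, $Y$ an object, $S:=T(-\times Y)^Y$, $\mathcal{A}_S=(\mathbb{C},S,A,a)$ a $\lambda_c(\Sigma)$-structure and $\mathcal{A}_T=(\mathbb{C},T,A,\mathrm{SPS}(a))$ the associated $\lambda_c(\mathrm{SPS}(\Sigma))$-structure. Let $\tau^T\colon T(\Omega)\to\Omega$ be an Eilenberg–Moore algebra and define $\tau^{S}:=(\tau^T)^Y\circ T(\mathrm{ev}_{\Omega,Y})^Y\colon T(\Omega^Y\times Y)^Y\to\Omega^Y$. For every well-typed term $\Gamma\vdash M\colon\mathbf{t}$ over $\Sigma$ and every post-condition $Q\colon[\![\mathbf{t}]\!]_S\to\Omega^Y$, $$\big(\mathrm{wp}^{\mathcal{A}_S}_{\tau^S}[M](Q)\circ\rho_\Gamma^{ -1}\big)^\dagger=\mathrm{wp}^{\mathcal{A}_T}_{\tau^T}[\mathrm{SPS}(M)]\big((Q\circ\rho_{\mathbf{t}}^{ -1})^\dagger\big).$$ In particular, if all types in $\Gamma$ and $\mathbf{t}$ are ground types, then $\big(\mathrm{wp}^{\mathcal{A}_S}_{\tau^S}[M](Q)\big)^\dagger=\mathrm{wp}^{\mathcal{A}_T}_{\tau^T}[\mathrm{SPS}(M)](Q^\dagger)$.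
   Context: Standing conventions: $\mathbb{C}$ is a stable bicartesian closed category; $\mathrm{ev}_{X,Y}\colon X^Y\times Y\to X$ is evaluation, $(\cdot)^\dagger$ is transposition along $(-\times Y)\dashv(-)^Y$ (here turning $X\to W^Y$ into $X\times Y\to W$). Strong monads have left strength $\mathrm{st}$ and right strength $\mathrm{st}'$. $S=T(-\times Y)^Y$ is the strong monad with unit $(\eta^T_{X\times Y})^\dagger$, multiplication $(\mu^T_{X\times Y}\circ T(\mathrm{ev}))^Y$, strength $(\mathrm{st}^T\circ(X\times\mathrm{ev}))^\dagger$. Syntax: base types $B$; types $\mathbf{t}::=b\mid\mathbf{1}\mid\mathbf{t}_1\times\mathbf{t}_2\mid\mathbf{0}\mid\mathbf{t}_1+\mathbf{t}_2\mid\mathbf{t}_1\to\mathbf{t}_2$; ground types have no $\to$. Signature $\Sigma=(B,K,E,\mathrm{ar},\mathrm{car})$ with constants $K$, generic effects $E$, $\mathrm{ar},\mathrm{car}\colon K+E\to$ ground types. Terms $x\mid c\,M\mid e\,M\mid()\mid(M,N)\mid\pi_iM\mid\delta(M)\mid\iota_iM\mid\delta(M,x_1\colon\mathbf{t}_1.N_1,x_2\colon\mathbf{t}_2.N_2)\mid\lambda x\colon\mathbf{t}.M\mid M\,N$ with standard typing. A $\lambda_c(\Sigma)$-structure $(\mathbb{C},T,A,a)$: $T$ strong monad, $A(b)$ object for $b\in B$, $a(c)\colon[\![\mathrm{ar}(c)]\!]\to[\![\mathrm{car}(c)]\!]$, $a(e)\colon[\![\mathrm{ar}(e)]\!]\to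 T[\![\mathrm{car}(e)]\!]$; types via the bi-CCC structure with $[\![\mathbf{t}_1\to\mathbf{t}_2]\!]=T[\![\mathbf{t}_2]\!]^{[\![\mathbf{t}_1]\!]}$, contexts as products; terms interpreted as $[\![M]\!]\colon[\![\Gamma]\!]\to T[\![\mathbf{t}]\!]$ by Moggi's call-by-value semantics: $[\![x_i]\!]=\eta\circ\pi_i$, $[\![()]\!]=\eta\circ!$, $[\![c\,M]\!]=T(a(c))\circ[\![M]\!]$, $[\![e\,M]\!]=\mu\circ T(a(e))\circ[\![M]\!]$, $[\![(M,N)]\!]=\mu\circ T(\mathrm{st})\circ\mathrm{st}'\circ\langle[\![M]\!],[\![N]\!]\rangle$, $[\![\pi_iM]\!]=T\pi_i\circ[\![M]\!]$, $[\![\iota_iM]\!]=T\iota_i\circ[\![M]\!]$, $[\![\delta(M)]\!]=T!\circ[\![M]\!]$, $[\![\delta(M,x_1.N_1,x_2.N_2)]\!]=\mu\circ T([[\![N_1]\!],[\![N_2]\!]]\circ\mathrm{dist})\circ\mathrm{st}\circ\langle\mathrm{id},[\![M]\!]\rangle$, $[\![\lambda x.M]\!]=\eta\circ[\![M]\!]^\dagger$, $[\![M\,N]\!]=\mu\circ T\mu\circ T^2(\mathrm{ev})\circ T(\mathrm{st})\circ\mathrm{st}'\circ\langle[\![M]\!],[\![N]\!]\rangle$. $[\![\cdot]\!]_S$, $[\![\cdot]\!]_T$ denote type interpretations under $\mathcal{A}_S,\mathcal{A}_T$. Weakest pre-condition: for an Eilenberg–Moore algebra $\tau\colon T\Omega\to\Omega$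 of the structure's monad and $Q\colon[\![\mathbf{t}]\!]\to\Omega$, $\mathrm{wp}^{\mathcal{A}}_\tau[M](Q):=\tau\circ T(Q)\circ[\![M]\!]^{\mathcal{A}}$. SPS transformation: add base type $b^Y$ with $A(b^Y)=Y$. Types: $\mathbf{t}^\circ=\mathbf{t}$ for $b,\mathbf{1},\mathbf{0}$; $(\cdot)^\circ$ commutes with $\times,+$; $(\mathbf{t}_1\to\mathbf{t}_2)^\circ=(\mathbf{t}_1^\circ\times b^Y)\to(\mathbf{t}_2^\circ\times b^Y)$; $\mathrm{SPS}(\mathbf{t})=\mathbf{t}^\circ\times b^Y$; $\mathrm{SPS}(x_1\colon\mathbf{t}_1,\dots,x_m\colon\mathbf{t}_m)=x_1\colon\mathbf{t}_1^\circ,\dots,x_m\colon\mathbf{t}_m^\circ,y\colon b^Y$. Terms ($z$ fresh): $\mathrm{SPS}(x)=(x,y)$; $\mathrm{SPS}(c\,M)=c\,\mathrm{SPS}(M)$; $\mathrm{SPS}(e\,M)=e\,\mathrm{SPS}(M)$; $\mathrm{SPS}(())=((),y)$; $\mathrm{SPS}((M,N))=(\lambda z.((\pi_1z,\pi_1\pi_2z),\pi_2\pi_2z))((\lambda z.(\pi_1z,(\lambda y.\mathrm{SPS}(N))(\pi_2z)))\mathrm{SPS}(M))$; $\mathrm{SPS}(\pi_iM)=(\lambda z.(\pi_i\pi_1z,\pi_2z))\mathrm{SPS}(M)$; $\mathrm{SPS}(\delta(M))=(\lambda z.(\delta(\pi_1z),\pi_2z))\mathrm{SPS}(M)$; $\mathrm{SPS}(\iota_iM)=(\lambda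 z.(\iota_i\pi_1z,\pi_2z))\mathrm{SPS}(M)$; $\mathrm{SPS}(\delta(M,x_1\colon\mathbf{t}_1.M_1,x_2\colon\mathbf{t}_2.M_2))=\delta(N,z\colon\mathrm{SPS}(\mathbf{t}_1).\mathrm{SPS}(M_1)[\pi_1z/x_1,\pi_2z/y],z\colon\mathrm{SPS}(\mathbf{t}_2).\mathrm{SPS}(M_2)[\pi_1z/x_2,\pi_2z/y])$ with $N=(\lambda z.\delta(\pi_1z,x_1\colon\mathbf{t}_1^\circ.\iota_1(x_1,\pi_2z),x_2\colon\mathbf{t}_2^\circ.\iota_2(x_2,\pi_2z)))\mathrm{SPS}(M)$; $\mathrm{SPS}(\lambda x\colon\mathbf{t}_1.M)=(\lambda z\colon\mathrm{SPS}(\mathbf{t}_1).\mathrm{SPS}(M)[\pi_1z/x,\pi_2z/y],y)$; $\mathrm{SPS}(M\,N)=(\lambda z.(\pi_1z)((\lambda y.\mathrm{SPS}(N))(\pi_2z)))\mathrm{SPS}(M)$. Signature $\mathrm{SPS}(\Sigma)=(B+\{b^Y\},K,E,\mathrm{ar}',\mathrm{car}')$ with $\mathrm{ar}'(k)=\mathrm{ar}(k)\times b^Y$, $\mathrm{car}'(k)=\mathrm{car}(k)\times b^Y$. Structure $\mathcal{A}_T=(\mathbb{C},T,A,\mathrm{SPS}(a))$ with $\mathrm{SPS}(a)(c)=a(c)\times\mathrm{id}_Y$ and $\mathrm{SPS}(a)(e)=a(e)^\dagger\colon[\![\mathrm{ar}(e)]\!]\times Y\to T([\![\mathrm{car}(e)]\!]\times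 Y)$. Isomorphisms $\rho_{\mathbf{t}}\colon[\![\mathbf{t}]\!]_S\to[\![\mathbf{t}^\circ]\!]_T$: identity for $\mathbf{0},\mathbf{1},b$; $\rho_{\mathbf{t}_1\times\mathbf{t}_2}=\rho_{\mathbf{t}_1}\times\rho_{\mathbf{t}_2}$; $\rho_{\mathbf{t}_1+\mathbf{t}_2}=\rho_{\mathbf{t}_1}+\rho_{\mathbf{t}_2}$; $\rho_{\mathbf{t}_1\to\mathbf{t}_2}=\cong\circ\,S(\rho_{\mathbf{t}_2})^{\rho_{\mathbf{t}_1}^{ -1}}$ (post-compose with $S(\rho_{\mathbf{t}_2})$, pre-compose with $\rho_{\mathbf{t}_1}^{ -1}$, then the currying isomorphism $(T(W\times Y)^Y)^V\cong T(W\times Y)^{V\times Y}$). For $\Gamma=x_1\colon\mathbf{t}_1,\dots,x_m\colon\mathbf{t}_m$, $\rho_\Gamma=\rho_{\mathbf{t}_1\times\cdots\times\mathbf{t}_m}$. -}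

module Defs where

open import Level using (Level; _⊔_)
open import Data.Unit using (⊤; tt)
open import Data.Sum using (_⊎_; inj₁; inj₂)
open import Relation.Binary using (IsEquivalence)
open import Relation.Binary.PropositionalEquality using (_≡_; refl; cong; cong₂; sym)

-- In a cartesian closed category finite coproducts are automatically
-- stable (-×X is a left adjoint), so "stable" imposes nothing further;
-- the distributivity map 'dist' is defined below.

record BCCC (o ℓ e : Level) : Set (Level.suc (o ⊔ ℓ ⊔ e)) where
  infixr 9 _∘_
  infix  4 _≈_
  infix  5 _⇒_
  infixr 7 _×_
  infixr 6 _+_
  infixl 8 _^_
  field
    Obj : Set o
    _⇒_ : Obj → Obj → Set ℓ
    _≈_ : ∀ {X Y} → X ⇒ Y → X ⇒ Y → Set e
    ≈-equiv : ∀ {X Y} → IsEquivalence (_≈_ {X} {Y})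
    id  : ∀ {X} → X ⇒ X
    _∘_ : ∀ {X Y Z} → Y ⇒ Z → X ⇒ Y → X ⇒ Z
    ∘-resp-≈ : ∀ {X Y Z} {f f' : Y ⇒ Z} {g g' : X ⇒ Y} → f ≈ f' → g ≈ g' → f ∘ g ≈ f' ∘ g'
    assoc : ∀ {W X Y Z} {f : Y ⇒ Z} {g : X ⇒ Y} {h : W ⇒ X} → (f ∘ g) ∘ h ≈ f ∘ (g ∘ h)
    identityˡ : ∀ {X Y} {f : X ⇒ Y} → id ∘ f ≈ f
    identityʳ : ∀ {X Y} {f : X ⇒ Y} → f ∘ id ≈ f
    𝟏 : Obj
    ! : ∀ {X} → X ⇒ 𝟏
    !-unique : ∀ {X} (f : X ⇒ 𝟏) → f ≈ !
    _×_ : Obj → Obj → Obj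
    π₁ : ∀ {X Y} → X × Y ⇒ X
    π₂ : ∀ {X Y} → X × Y ⇒ Y
    ⟨_,_⟩ : ∀ {W X Y} → W ⇒ X → W ⇒ Y → W ⇒ X × Y
    π₁-β : ∀ {W X Y} {f : W ⇒ X} {g : W ⇒ Y} → π₁ ∘ ⟨ f , g ⟩ ≈ f
    π₂-β : ∀ {W X Y} {f : W ⇒ X} {g : W ⇒ Y} → π₂ ∘ ⟨ f , g ⟩ ≈ g
    ⟨⟩-unique : ∀ {W X Y} {f : W ⇒ X} {g : W ⇒ Y} {h : W ⇒ X × Y} →
                π₁ ∘ h ≈ f → π₂ ∘ h ≈ g → h ≈ ⟨ f , g ⟩
    𝟎 : Obj
    ¡ : ∀ {X} → 𝟎 ⇒ X
    ¡-unique : ∀ {X} (f : 𝟎 ⇒ X) → f ≈ ¡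
    _+_ : Obj → Obj → Obj
    ι₁ : ∀ {X Y} → X ⇒ X + Y
    ι₂ : ∀ {X Y} → Y ⇒ X + Y
    [_,_] : ∀ {X Y W} → X ⇒ W → Y ⇒ W → X + Y ⇒ W
    ι₁-β : ∀ {X Y W} {f : X ⇒ W} {g : Y ⇒ W} → [ f , g ] ∘ ι₁ ≈ f
    ι₂-β : ∀ {X Y W} {f : X ⇒ W} {g : Y ⇒ W} → [ f , g ] ∘ ι₂ ≈ g
    []-unique : ∀ {X Y W} {f : X ⇒ W} {g : Y ⇒ W} {h : X + Y ⇒ W} →
                h ∘ ι₁ ≈ f → h ∘ ι₂ ≈ g → h ≈ [ f , g ]
    _^_ : Obj → Obj → Obj
    ev : ∀ {X Y} → X ^ Y × Y ⇒ X
    curry : ∀ {W X Y} → W × Y ⇒ X → W ⇒ X ^ Y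
    curry-β : ∀ {W X Y} {f : W × Y ⇒ X} → ev ∘ ⟨ curry f ∘ π₁ , π₂ ⟩ ≈ f
    curry-unique : ∀ {W X Y} {f : W × Y ⇒ X} {h : W ⇒ X ^ Y} →
                   ev ∘ ⟨ h ∘ π₁ , π₂ ⟩ ≈ f → h ≈ curry f

  _×₁_ : ∀ {X X' Y Y'} → X ⇒ X' → Y ⇒ Y' → X × Y ⇒ X' × Y'
  f ×₁ g = ⟨ f ∘ π₁ , g ∘ π₂ ⟩

  _+₁_ : ∀ {X X' Y Y'} → X ⇒ X' → Y ⇒ Y' → X + Y ⇒ X' + Y'
  f +₁ g = [ ι₁ ∘ f , ι₂ ∘ g ]

  -- transposition  (X ⇒ W ^ Y)  ↦  (X × Y ⇒ W)   (the paper's  (·)^† )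
  uncurry : ∀ {X Y W} → X ⇒ W ^ Y → X × Y ⇒ W
  uncurry f = ev ∘ (f ×₁ id)

  _^₁_ : ∀ {X X'} → X ⇒ X' → (Y : Obj) → X ^ Y ⇒ X' ^ Y
  f ^₁ Y = curry (f ∘ ev)

  expMap : ∀ {X X' V V'} → X ⇒ X' → V' ⇒ V → X ^ V ⇒ X' ^ V'
  expMap f g = curry (f ∘ ev ∘ (id ×₁ g))

  swap : ∀ {X Y} → X × Y ⇒ Y × X
  swap = ⟨ π₂ , π₁ ⟩

  α : ∀ {X Y Z} → (X × Y) × Z ⇒ X × (Y × Z)
  α = ⟨ π₁ ∘ π₁ , ⟨ π₂ ∘ π₁ , π₂ ⟩ ⟩

  α⁻¹ : ∀ {X Y Z} → X × (Y × Z) ⇒ (X × Y) × Z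
  α⁻¹ = ⟨ ⟨ π₁ , π₁ ∘ π₂ ⟩ , π₂ ∘ π₂ ⟩

  -- distributivity  X × (A + B) → X × A + X × B  (inverse of [id×ι₁ , id×ι₂])
  dist : ∀ {X A B} → X × (A + B) ⇒ (X × A) + (X × B)
  dist = uncurry [ curry (ι₁ ∘ swap) , curry (ι₂ ∘ swap) ] ∘ swap

  curryIso : ∀ {Z Y V} → (Z ^ Y) ^ V ⇒ Z ^ (V × Y)
  curryIso = curry (ev ∘ (ev ×₁ id) ∘ α⁻¹)

  curryIso⁻¹ : ∀ {Z Y V} → Z ^ (V × Y) ⇒ (Z ^ Y) ^ V
  curryIso⁻¹ = curry (curry (ev ∘ α))

  cast : ∀ {X X' Z Z'} → X ≡ X' → Z ≡ Z' → X ⇒ Z → X' ⇒ Z'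
  cast refl refl f = f

module _ {o ℓ e} (C : BCCC o ℓ e) where
  open BCCC C

  record MonadOps : Set (o ⊔ ℓ) where
    field
      F₀ : Obj → Obj
      F₁ : ∀ {X Y} → X ⇒ Y → F₀ X ⇒ F₀ Y
      η  : ∀ {X} → X ⇒ F₀ X
      μ  : ∀ {X} → F₀ (F₀ X) ⇒ F₀ X
      st : ∀ {X Y} → X × F₀ Y ⇒ F₀ (X × Y)

    st' : ∀ {X Y} → F₀ X × Y ⇒ F₀ (X × Y)
    st' = F₁ swap ∘ st ∘ swap

  record IsStrongMonad (M : MonadOps) : Set (o ⊔ ℓ ⊔ e) where
    open MonadOps M
    field
      F-cong : ∀ {X Y} {f g : X ⇒ Y} → f ≈ g → F₁ f ≈ F₁ g
      F-id : ∀ {X} → F₁ (id {X}) ≈ id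
      F-∘ : ∀ {X Y Z} {f : X ⇒ Y} {g : Y ⇒ Z} → F₁ (g ∘ f) ≈ F₁ g ∘ F₁ f
      η-nat : ∀ {X Y} {f : X ⇒ Y} → η ∘ f ≈ F₁ f ∘ η
      μ-nat : ∀ {X Y} {f : X ⇒ Y} → μ ∘ F₁ (F₁ f) ≈ F₁ f ∘ μ
      μ-ηˡ : ∀ {X} → μ ∘ η {F₀ X} ≈ id
      μ-ηʳ : ∀ {X} → μ ∘ F₁ (η {X}) ≈ id
      μ-assoc : ∀ {X} → μ ∘ F₁ (μ {X}) ≈ μ ∘ μ {F₀ X}
      st-nat : ∀ {X X' Y Y'} {f : X ⇒ X'} {g : Y ⇒ Y'} →
               st ∘ (f ×₁ F₁ g) ≈ F₁ (f ×₁ g) ∘ st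
      st-unit : ∀ {X} → F₁ π₂ ∘ st {𝟏} {X} ≈ π₂
      st-assoc : ∀ {X Y Z} → F₁ α ∘ st {X × Y} {Z} ≈ st ∘ (id ×₁ st) ∘ α
      st-η : ∀ {X Y} → st ∘ (id ×₁ η) ≈ η {X × Y}
      st-μ : ∀ {X Y} → st ∘ (id ×₁ μ) ≈ μ ∘ F₁ st ∘ st {X} {F₀ Y}

  record StrongMonad : Set (o ⊔ ℓ ⊔ e) where
    field
      ops : MonadOps
      isStrongMonad : IsStrongMonad ops
    open MonadOps ops public

  record EMAlgebra (T : StrongMonad) (Ω : Obj) : Set (ℓ ⊔ e) where
    open StrongMonad T
    field
      τ : F₀ Ω ⇒ Ω
      τ-η : τ ∘ η ≈ id
      τ-μ : τ ∘ μ ≈ τ ∘ F₁ τ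

  SOps : MonadOps → Obj → MonadOps
  SOps T Y = record
    { F₀ = λ X → F₀ (X × Y) ^ Y
    ; F₁ = λ f → curry (F₁ (f ×₁ id) ∘ ev)
    ; η  = curry η
    ; μ  = curry (μ ∘ F₁ ev ∘ ev)
    ; st = curry (F₁ α⁻¹ ∘ st ∘ (id ×₁ ev) ∘ α)
    }
    where open MonadOps T

infixr 7 _⊗_
infixr 6 _⊕_
infixr 5 _⇛_

data Ty (B : Set) : Set where
  base : B → Ty B
  𝟙 : Ty B
  _⊗_ : Ty B → Ty B → Ty B
  𝟘 : Ty B
  _⊕_ : Ty B → Ty B → Ty B
  _⇛_ : Ty B → Ty B → Ty B

data Ground {B : Set} : Ty B → Set where
  base : ∀ b → Ground (base b)
  𝟙 : Ground 𝟙
  _⊗_ : ∀ {s t} → Ground s → Ground t → Ground (s ⊗ t)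
  𝟘 : Ground 𝟘
  _⊕_ : ∀ {s t} → Ground s → Ground t → Ground (s ⊕ t)

infixl 4 _▸_
data Ctx (B : Set) : Set where
  ε : Ctx B
  _▸_ : Ctx B → Ty B → Ctx B

infix 3 _∋_
data _∋_ {B : Set} : Ctx B → Ty B → Set where
  Z : ∀ {Γ t} → Γ ▸ t ∋ t
  S : ∀ {Γ s t} → Γ ∋ t → Γ ▸ s ∋ t

data AllGround {B : Set} : Ctx B → Set where
  ε : AllGround ε
  _▸_ : ∀ {Γ t} → AllGround Γ → Ground t → AllGround (Γ ▸ t)

record Signature : Set₁ where
  field
    B K E : Set
    ar car : K ⊎ E → Ty B
    ar-ground : ∀ k → Ground (ar k)
    car-ground : ∀ k → Ground (car k)

open Signature

data Term (Sig : Signature) (Γ : Ctx (B Sig)) : Ty (B Sig) → Set where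
  var : ∀ {t} → Γ ∋ t → Term Sig Γ t
  con : (c : K Sig) → Term Sig Γ (ar Sig (inj₁ c)) → Term Sig Γ (car Sig (inj₁ c))
  eff : (e : E Sig) → Term Sig Γ (ar Sig (inj₂ e)) → Term Sig Γ (car Sig (inj₂ e))
  unit : Term Sig Γ 𝟙
  pair : ∀ {s t} → Term Sig Γ s → Term Sig Γ t → Term Sig Γ (s ⊗ t)
  fst : ∀ {s t} → Term Sig Γ (s ⊗ t) → Term Sig Γ s
  snd : ∀ {s t} → Term Sig Γ (s ⊗ t) → Term Sig Γ t
  absurd : ∀ {t} → Term Sig Γ 𝟘 → Term Sig Γ t
  inl : ∀ {s t} → Term Sig Γ s → Term Sig Γ (s ⊕ t)
  inr : ∀ {s t} → Term Sig Γ t → Term Sig Γ (s ⊕ t)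
  case : ∀ {s t u} → Term Sig Γ (s ⊕ t) → Term Sig (Γ ▸ s) u → Term Sig (Γ ▸ t) u → Term Sig Γ u
  lam : ∀ {s t} → Term Sig (Γ ▸ s) t → Term Sig Γ (s ⇛ t)
  app : ∀ {s t} → Term Sig Γ (s ⇛ t) → Term Sig Γ s → Term Sig Γ t

module _ {Sig : Signature} where
  Ren : Ctx (B Sig) → Ctx (B Sig) → Set
  Ren Γ Δ = ∀ {t} → Γ ∋ t → Δ ∋ t

  Sub : Ctx (B Sig) → Ctx (B Sig) → Set
  Sub Γ Δ = ∀ {t} → Γ ∋ t → Term Sig Δ t

  ext : ∀ {Γ Δ s} → Ren Γ Δ → Ren (Γ ▸ s) (Δ ▸ s)
  ext ρ Z = Z
  ext ρ (S x) = S (ρ x)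

  rename : ∀ {Γ Δ t} → Ren Γ Δ → Term Sig Γ t → Term Sig Δ t
  rename ρ (var x) = var (ρ x)
  rename ρ (con c M) = con c (rename ρ M)
  rename ρ (eff e M) = eff e (rename ρ M)
  rename ρ unit = unit
  rename ρ (pair M N) = pair (rename ρ M) (rename ρ N)
  rename ρ (fst M) = fst (rename ρ M)
  rename ρ (snd M) = snd (rename ρ M)
  rename ρ (absurd M) = absurd (rename ρ M)
  rename ρ (inl M) = inl (rename ρ M)
  rename ρ (inr M) = inr (rename ρ M)
  rename ρ (case M N₁ N₂) = case (rename ρ M) (rename (ext ρ) N₁) (rename (ext ρ) N₂)
  rename ρ (lam M) = lam (rename (ext ρ) M)
  rename ρ (app M N) = app (rename ρ M) (rename ρ N)

  exts : ∀ {Γ Δ s} → Sub Γ Δ → Sub (Γ ▸ s) (Δ ▸ s)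
  exts σ Z = var Z
  exts σ (S x) = rename S (σ x)

  subst : ∀ {Γ Δ t} → Sub Γ Δ → Term Sig Γ t → Term Sig Δ t
  subst σ (var x) = σ x
  subst σ (con c M) = con c (subst σ M)
  subst σ (eff e M) = eff e (subst σ M)
  subst σ unit = unit
  subst σ (pair M N) = pair (subst σ M) (subst σ N)
  subst σ (fst M) = fst (subst σ M)
  subst σ (snd M) = snd (subst σ M)
  subst σ (absurd M) = absurd (subst σ M)
  subst σ (inl M) = inl (subst σ M)
  subst σ (inr M) = inr (subst σ M)
  subst σ (case M N₁ N₂) = case (subst σ M) (subst (exts σ) N₁) (subst (exts σ) N₂)
  subst σ (lam M) = lam (subst (exts σ) M)
  subst σ (app M N) = app (subst σ M) (subst σ N)

module _ {o ℓ e} (C : BCCC o ℓ e) where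
  open BCCC C

  ⟦_⟧ty : ∀ {B : Set} → Ty B → (B → Obj) → (Obj → Obj) → Obj
  ⟦ base b ⟧ty A F = A b
  ⟦ 𝟙 ⟧ty A F = 𝟏
  ⟦ s ⊗ t ⟧ty A F = ⟦ s ⟧ty A F × ⟦ t ⟧ty A F
  ⟦ 𝟘 ⟧ty A F = 𝟎
  ⟦ s ⊕ t ⟧ty A F = ⟦ s ⟧ty A F + ⟦ t ⟧ty A F
  ⟦ s ⇛ t ⟧ty A F = F (⟦ t ⟧ty A F) ^ ⟦ s ⟧ty A F

  ⟦_⟧ctx : ∀ {B : Set} → Ctx B → (B → Obj) → (Obj → Obj) → Obj
  ⟦ ε ⟧ctx A F = 𝟏
  ⟦ Γ ▸ t ⟧ctx A F = ⟦ Γ ⟧ctx A F × ⟦ t ⟧ty A F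

  record Structure (M : MonadOps C) (Sig : Signature) : Set (o ⊔ ℓ) where
    open MonadOps M
    field
      A  : B Sig → Obj
      ac : (c : K Sig) → ⟦ ar Sig (inj₁ c) ⟧ty A F₀ ⇒ ⟦ car Sig (inj₁ c) ⟧ty A F₀
      ae : (e : E Sig) → ⟦ ar Sig (inj₂ e) ⟧ty A F₀ ⇒ F₀ (⟦ car Sig (inj₂ e) ⟧ty A F₀)

  module Semantics {M : MonadOps C} {Sig : Signature} (𝒜 : Structure M Sig) where
    open MonadOps M
    open Structure 𝒜

    ⟦_⟧ : Ty (B Sig) → Obj
    ⟦ t ⟧ = ⟦ t ⟧ty A F₀

    ⟦_⟧c : Ctx (B Sig) → Obj
    ⟦ Γ ⟧c = ⟦ Γ ⟧ctx A F₀

    proj : ∀ {Γ t} → Γ ∋ t → ⟦ Γ ⟧c ⇒ ⟦ t ⟧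
    proj Z = π₂
    proj (S x) = proj x ∘ π₁

    ⟦_⟧tm : ∀ {Γ t} → Term Sig Γ t → ⟦ Γ ⟧c ⇒ F₀ ⟦ t ⟧
    ⟦ var x ⟧tm = η ∘ proj x
    ⟦ con c M ⟧tm = F₁ (ac c) ∘ ⟦ M ⟧tm
    ⟦ eff e M ⟧tm = μ ∘ F₁ (ae e) ∘ ⟦ M ⟧tm
    ⟦ unit ⟧tm = η ∘ !
    ⟦ pair M N ⟧tm = μ ∘ F₁ st ∘ st' ∘ ⟨ ⟦ M ⟧tm , ⟦ N ⟧tm ⟩
    ⟦ fst M ⟧tm = F₁ π₁ ∘ ⟦ M ⟧tm
    ⟦ snd M ⟧tm = F₁ π₂ ∘ ⟦ M ⟧tm
    ⟦ absurd M ⟧tm = F₁ ¡ ∘ ⟦ M ⟧tm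
    ⟦ inl M ⟧tm = F₁ ι₁ ∘ ⟦ M ⟧tm
    ⟦ inr M ⟧tm = F₁ ι₂ ∘ ⟦ M ⟧tm
    ⟦ case M N₁ N₂ ⟧tm = μ ∘ F₁ ([ ⟦ N₁ ⟧tm , ⟦ N₂ ⟧tm ] ∘ dist) ∘ st ∘ ⟨ id , ⟦ M ⟧tm ⟩
    ⟦ lam M ⟧tm = η ∘ curry ⟦ M ⟧tm
    ⟦ app M N ⟧tm = μ ∘ F₁ μ ∘ F₁ (F₁ ev) ∘ F₁ st ∘ st' ∘ ⟨ ⟦ M ⟧tm , ⟦ N ⟧tm ⟩

    wp : ∀ {Ω Γ t} → F₀ Ω ⇒ Ω → Term Sig Γ t → ⟦ t ⟧ ⇒ Ω → ⟦ Γ ⟧c ⇒ Ω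
    wp τ M Q = τ ∘ F₁ Q ∘ ⟦ M ⟧tm

bY : ∀ {B : Set} → Ty (B ⊎ ⊤)
bY = base (inj₂ tt)

_° : ∀ {B : Set} → Ty B → Ty (B ⊎ ⊤)
base b ° = base (inj₁ b)
𝟙 ° = 𝟙
(s ⊗ t) ° = s ° ⊗ t °
𝟘 ° = 𝟘
(s ⊕ t) ° = s ° ⊕ t °
(s ⇛ t) ° = (s ° ⊗ bY) ⇛ (t ° ⊗ bY)

SPSty : ∀ {B : Set} → Ty B → Ty (B ⊎ ⊤)
SPSty t = t ° ⊗ bY

ground-° : ∀ {B : Set} {t : Ty B} → Ground t → Ground (t °)
ground-° (base b) = base (inj₁ b)
ground-° 𝟙 = 𝟙
ground-° (g ⊗ h) = ground-° g ⊗ ground-° h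
ground-° 𝟘 = 𝟘
ground-° (g ⊕ h) = ground-° g ⊕ ground-° h

ctx° : ∀ {B : Set} → Ctx B → Ctx (B ⊎ ⊤)
ctx° ε = ε
ctx° (Γ ▸ t) = ctx° Γ ▸ t °

SPSctx : ∀ {B : Set} → Ctx B → Ctx (B ⊎ ⊤)
SPSctx Γ = ctx° Γ ▸ bY

var° : ∀ {B : Set} {Γ : Ctx B} {t} → Γ ∋ t → ctx° Γ ∋ t °
var° Z = Z
var° (S x) = S (var° x)

-- the signature SPS(Σ); for ground types t, t° is t with base types
-- viewed in B + {b^Y}
SPSSig : Signature → Signature
SPSSig Sig = record
  { B = B Sig ⊎ ⊤
  ; K = K Sig
  ; E = E Sig
  ; ar = λ k → ar Sig k ° ⊗ bY
  ; car = λ k → car Sig k ° ⊗ bY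
  ; ar-ground = λ k → ground-° (ar-ground Sig k) ⊗ base (inj₂ tt)
  ; car-ground = λ k → ground-° (car-ground Sig k) ⊗ base (inj₂ tt)
  }

module _ {Sig : Signature} where
  private
    Sig' = SPSSig Sig

  -- rename SPS(N) : (Γ°, y) into (Γ°, y, z:u, y)   (for  λy.SPS(N)  under  λz)
  reY : ∀ {Γ u t} → Term Sig' (SPSctx Γ) t → Term Sig' (SPSctx Γ ▸ u ▸ bY) t
  reY = rename r
    where
      r : ∀ {Γ u} → Ren {Sig'} (SPSctx Γ) (SPSctx Γ ▸ u ▸ bY)
      r Z = Z
      r (S x) = S (S (S x))

  -- M[π₁z/x, π₂z/y] : from (Γ°, x:s°, y) to (Γ°, y, z:SPS(s))
  rebind : ∀ {Γ s t} → Term Sig' (ctx° Γ ▸ s ° ▸ bY) t → Term Sig' (SPSctx Γ ▸ SPSty s) t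
  rebind = subst σ
    where
      σ : ∀ {Γ s} → Sub {Sig'} (ctx° Γ ▸ s ° ▸ bY) (SPSctx Γ ▸ SPSty s)
      σ Z = snd (var Z)
      σ (S Z) = fst (var Z)
      σ (S (S x)) = var (S (S x))

  z : ∀ {Δ : Ctx (B Sig')} {t} → Term Sig' (Δ ▸ t) t
  z = var Z

  SPS : ∀ {Γ t} → Term Sig Γ t → Term Sig' (SPSctx Γ) (SPSty t)
  SPS (var x) = pair (var (S (var° x))) (var Z)
  SPS (con c M) = con c (SPS M)
  SPS (eff e M) = eff e (SPS M)
  SPS unit = pair unit (var Z)
  SPS (pair M N) =
    app (lam (pair (pair (fst z) (fst (snd z))) (snd (snd z))))
        (app (lam (pair (fst z) (app (lam (reY (SPS N))) (snd z)))) (SPS M))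
  SPS (fst M) = app (lam (pair (fst (fst z)) (snd z))) (SPS M)
  SPS (snd M) = app (lam (pair (snd (fst z)) (snd z))) (SPS M)
  SPS (absurd M) = app (lam (pair (absurd (fst z)) (snd z))) (SPS M)
  SPS (inl M) = app (lam (pair (inl (fst z)) (snd z))) (SPS M)
  SPS (inr M) = app (lam (pair (inr (fst z)) (snd z))) (SPS M)
  SPS (case M M₁ M₂) = case N (rebind (SPS M₁)) (rebind (SPS M₂))
    where
      N = app (lam (case (fst z) (inl (pair (var Z) (snd (var (S Z)))))
                                 (inr (pair (var Z) (snd (var (S Z)))))))
              (SPS M)
  SPS (lam M) = pair (lam (rebind (SPS M))) (var Z)
  SPS (app M N) = app (lam (app (fst z) (app (lam (reY (SPS N))) (snd z)))) (SPS M)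

module SPSSetting {o ℓ e} (C : BCCC o ℓ e) (T : StrongMonad C) (Y : BCCC.Obj C)
                  (Sig : Signature) (𝒜S : Structure C (SOps C (StrongMonad.ops T) Y) Sig) where
  open BCCC C
  open StrongMonad T using (ops)
  module T = MonadOps ops
  module Sₘ = MonadOps (SOps C ops Y)
  open Structure 𝒜S

  A' : B Sig ⊎ ⊤ → Obj
  A' (inj₁ b) = A b
  A' (inj₂ _) = Y

  ⟦_⟧S : Ty (B Sig) → Obj
  ⟦ t ⟧S = ⟦_⟧ty C t A Sₘ.F₀

  ⟦_⟧T : Ty (B Sig ⊎ ⊤) → Obj
  ⟦ t ⟧T = ⟦_⟧ty C t A' T.F₀

  ⟦_⟧Sc : Ctx (B Sig) → Obj
  ⟦ Γ ⟧Sc = ⟦_⟧ctx C Γ A Sₘ.F₀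

  ⟦_⟧Tc : Ctx (B Sig ⊎ ⊤) → Obj
  ⟦ Γ ⟧Tc = ⟦_⟧ctx C Γ A' T.F₀

  groundEq : ∀ {t} → Ground t → ⟦ t ° ⟧T ≡ ⟦ t ⟧S
  groundEq (base b) = refl
  groundEq 𝟙 = refl
  groundEq (g ⊗ h) = cong₂ _×_ (groundEq g) (groundEq h)
  groundEq 𝟘 = refl
  groundEq (g ⊕ h) = cong₂ _+_ (groundEq g) (groundEq h)

  ctxGroundEq : ∀ {Γ} → AllGround Γ → ⟦ ctx° Γ ⟧Tc ≡ ⟦ Γ ⟧Sc
  ctxGroundEq ε = refl
  ctxGroundEq (gΓ ▸ g) = cong₂ _×_ (ctxGroundEq gΓ) (groundEq g)

  𝒜T : Structure C ops (SPSSig Sig)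
  𝒜T = record
    { A = A'
    ; ac = λ c → cast (cong (_× Y) (sym (groundEq (ar-ground Sig (inj₁ c)))))
                      (cong (_× Y) (sym (groundEq (car-ground Sig (inj₁ c)))))
                      (ac c ×₁ id)
    ; ae = λ e → cast (cong (_× Y) (sym (groundEq (ar-ground Sig (inj₂ e)))))
                      (cong (λ X → T.F₀ (X × Y)) (sym (groundEq (car-ground Sig (inj₂ e)))))
                      (uncurry (ae e))
    }

  ρ : ∀ t → ⟦ t ⟧S ⇒ ⟦ t ° ⟧T
  ρ⁻¹ : ∀ t → ⟦ t ° ⟧T ⇒ ⟦ t ⟧S
  ρ (base b) = id
  ρ 𝟙 = id
  ρ (s ⊗ t) = ρ s ×₁ ρ t
  ρ 𝟘 = id
  ρ (s ⊕ t) = ρ s +₁ ρ t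
  ρ (s ⇛ t) = curryIso ∘ expMap (Sₘ.F₁ (ρ t)) (ρ⁻¹ s)
  ρ⁻¹ (base b) = id
  ρ⁻¹ 𝟙 = id
  ρ⁻¹ (s ⊗ t) = ρ⁻¹ s ×₁ ρ⁻¹ t
  ρ⁻¹ 𝟘 = id
  ρ⁻¹ (s ⊕ t) = ρ⁻¹ s +₁ ρ⁻¹ t
  ρ⁻¹ (s ⇛ t) = expMap (Sₘ.F₁ (ρ⁻¹ t)) (ρ s) ∘ curryIso⁻¹

  ρCtx⁻¹ : ∀ Γ → ⟦ ctx° Γ ⟧Tc ⇒ ⟦ Γ ⟧Sc
  ρCtx⁻¹ ε = id
  ρCtx⁻¹ (Γ ▸ t) = ρCtx⁻¹ Γ ×₁ ρ⁻¹ t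

  τS : ∀ {Ω} → T.F₀ Ω ⇒ Ω → Sₘ.F₀ (Ω ^ Y) ⇒ Ω ^ Y
  τS τ = (τ ^₁ Y) ∘ (T.F₁ ev ^₁ Y)

  wpS : ∀ {Ω' Γ t} → Sₘ.F₀ Ω' ⇒ Ω' → Term Sig Γ t → ⟦ t ⟧S ⇒ Ω' → ⟦ Γ ⟧Sc ⇒ Ω'
  wpS = Semantics.wp C 𝒜S

  wpT : ∀ {Ω Γ t} → T.F₀ Ω ⇒ Ω → Term (SPSSig Sig) Γ t → ⟦ t ⟧T ⇒ Ω → ⟦ Γ ⟧Tc ⇒ Ω
  wpT = Semantics.wp C 𝒜T

-- Transposition along (- × Y) ⊣ (-)^Y turns an S-computation Γ → T(t × Y)^Y into a
-- state-passing T-computation Γ × Y → T(t × Y), and SPS is the syntactic form of this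
-- transposition. The heart of the proof is therefore the simulation property
--   ⟦SPS M⟧_T = T(ρ_t × Y) ∘ ⟦M⟧_S^† ∘ (ρ_Γ⁻¹ × Y),
-- proved by induction on M: the transposes of η^S, μ^S and st^S are explicit composites of
-- the T-operations, and the administrative redexes (λz. K) N inserted by SPS denote Kleisli
-- lets. The weakest-precondition identity follows because the transpose of τ^S is
-- τ^T ∘ T(ev). On ground types every ρ is
-- an identity, up to the equation between the two interpretations of the type.

module Submission where

open import Data.Product using (proj₁; proj₂; _,_) renaming (_×_ to _∧_)
open import Data.Sum using (inj₁; inj₂)
open import Relation.Binary.Bundles using (Setoid)
open import Relation.Binary.PropositionalEquality using (_≡_; refl; cong; cong₂; sym)
import Relation.Binary.Reasoning.Setoid as SetoidReasoning

open import Defs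

module BCCCProperties {o ℓ e} (C : BCCC o ℓ e) where
  open BCCC C

  private
    variable
      A A' B D X X' Q Q' W V : Obj

  hom-setoid : Obj → Obj → Setoid ℓ e
  hom-setoid X Q = record { Carrier = X ⇒ Q ; _≈_ = _≈_ ; isEquivalence = ≈-equiv }

  module _ {X Q : Obj} where
    open Setoid (hom-setoid X Q) public using () renaming (refl to refl≈; sym to sym≈; trans to trans≈)
    open SetoidReasoning (hom-setoid X Q) public

  infixr 4 _⟩∘⟨_ refl⟩∘⟨_
  infixl 5 _⟩∘⟨refl
  _⟩∘⟨_ : ∀ {f f' : A ⇒ B} {g g' : X ⇒ A} → f ≈ f' → g ≈ g' → f ∘ g ≈ f' ∘ g'
  _⟩∘⟨_ = ∘-resp-≈
  refl⟩∘⟨_ : ∀ {f : A ⇒ B} {g g' : X ⇒ A} → g ≈ g' → f ∘ g ≈ f ∘ g'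
  refl⟩∘⟨ p = ∘-resp-≈ refl≈ p
  _⟩∘⟨refl : ∀ {f f' : A ⇒ B} {g : X ⇒ A} → f ≈ f' → f ∘ g ≈ f' ∘ g
  p ⟩∘⟨refl = ∘-resp-≈ p refl≈

  sym-assoc : ∀ {f : A ⇒ B} {g : X ⇒ A} {h : W ⇒ X} → f ∘ (g ∘ h) ≈ (f ∘ g) ∘ h
  sym-assoc = sym≈ assoc

  assoc² : ∀ {A B C' D' E} {a : D' ⇒ E} {b : C' ⇒ D'} {c : B ⇒ C'} {x : A ⇒ B} →
           (a ∘ b ∘ c) ∘ x ≈ a ∘ b ∘ c ∘ x
  assoc² = trans≈ assoc (refl⟩∘⟨ assoc)

  assoc³ : ∀ {A B C' D' E F'} {a : E ⇒ F'} {b : D' ⇒ E} {c : C' ⇒ D'} {d : B ⇒ C'} {x : A ⇒ B} →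
           (a ∘ b ∘ c ∘ d) ∘ x ≈ a ∘ b ∘ c ∘ d ∘ x
  assoc³ = trans≈ assoc (refl⟩∘⟨ assoc²)

  assoc⁴ : ∀ {A B C' D' E F' G'} {a : F' ⇒ G'} {b : E ⇒ F'} {c : D' ⇒ E} {d : C' ⇒ D'} {d' : B ⇒ C'} {x : A ⇒ B} →
           (a ∘ b ∘ c ∘ d ∘ d') ∘ x ≈ a ∘ b ∘ c ∘ d ∘ d' ∘ x
  assoc⁴ = trans≈ assoc (refl⟩∘⟨ assoc³)

  assoc⁵ : ∀ {A B C' D' E F' G' H'} {a : G' ⇒ H'} {b : F' ⇒ G'} {c : E ⇒ F'} {d : D' ⇒ E} {d' : C' ⇒ D'}
             {d'' : B ⇒ C'} {x : A ⇒ B} →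
           (a ∘ b ∘ c ∘ d ∘ d' ∘ d'') ∘ x ≈ a ∘ b ∘ c ∘ d ∘ d' ∘ d'' ∘ x
  assoc⁵ = trans≈ assoc (refl⟩∘⟨ assoc⁴)

  pullˡ : ∀ {a : A ⇒ B} {b : X ⇒ A} {c : X ⇒ B} {f : W ⇒ X} → a ∘ b ≈ c → a ∘ (b ∘ f) ≈ c ∘ f
  pullˡ p = trans≈ sym-assoc (p ⟩∘⟨refl)

  pullʳ : ∀ {a : A ⇒ B} {b : X ⇒ A} {c : W ⇒ X} {d : W ⇒ A} → b ∘ c ≈ d → (a ∘ b) ∘ c ≈ a ∘ d
  pullʳ p = trans≈ assoc (refl⟩∘⟨ p)

  pushʳ : ∀ {a : A ⇒ B} {g : X ⇒ A} {f : W ⇒ A} {h : X ⇒ W} → g ≈ f ∘ h → a ∘ g ≈ (a ∘ f) ∘ h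
  pushʳ p = trans≈ (refl⟩∘⟨ p) sym-assoc

  elimʳ : ∀ {f : X ⇒ Q} {g : X ⇒ X} → g ≈ id → f ∘ g ≈ f
  elimʳ p = trans≈ (refl⟩∘⟨ p) identityʳ

  elimˡ : ∀ {f : X ⇒ Q} {g : Q ⇒ Q} → g ≈ id → g ∘ f ≈ f
  elimˡ p = trans≈ (p ⟩∘⟨refl) identityˡ

  cancelˡ : ∀ {a : A ⇒ X} {b : X ⇒ A} {f : W ⇒ X} → a ∘ b ≈ id → a ∘ (b ∘ f) ≈ f
  cancelˡ p = trans≈ (pullˡ p) identityˡ

  split-epi-cancelʳ : ∀ {j : V ⇒ W} {j' : W ⇒ V} {p q : W ⇒ X} → j ∘ j' ≈ id → p ∘ j ≈ q ∘ j → p ≈ q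
  split-epi-cancelʳ {p = p} {q} jj' pj = begin
    p             ≈⟨ elimʳ jj' ⟨
    p ∘ _ ∘ _     ≈⟨ trans≈ sym-assoc (trans≈ (pj ⟩∘⟨refl) assoc) ⟩
    q ∘ _ ∘ _     ≈⟨ elimʳ jj' ⟩
    q             ∎

  ⟨⟩-cong : ∀ {f f' : W ⇒ X} {g g' : W ⇒ Q} → f ≈ f' → g ≈ g' → ⟨ f , g ⟩ ≈ ⟨ f' , g' ⟩
  ⟨⟩-cong p q = ⟨⟩-unique (trans≈ π₁-β p) (trans≈ π₂-β q)

  ⟨⟩∘ : ∀ {f : W ⇒ X} {g : W ⇒ Q} {h : V ⇒ W} → ⟨ f , g ⟩ ∘ h ≈ ⟨ f ∘ h , g ∘ h ⟩
  ⟨⟩∘ = ⟨⟩-unique (pullˡ π₁-β) (pullˡ π₂-β)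

  ⟨⟩-η : ∀ {X Q} → ⟨ π₁ {X} {Q} , π₂ ⟩ ≈ id
  ⟨⟩-η = sym≈ (⟨⟩-unique identityʳ identityʳ)

  ⟨π₁∘,π₂∘⟩ : ∀ {h : W ⇒ X × Q} → h ≈ ⟨ π₁ ∘ h , π₂ ∘ h ⟩
  ⟨π₁∘,π₂∘⟩ = ⟨⟩-unique refl≈ refl≈

  ×-cong : ∀ {f f' : X ⇒ X'} {g g' : Q ⇒ Q'} → f ≈ f' → g ≈ g' → f ×₁ g ≈ f' ×₁ g'
  ×-cong p q = ⟨⟩-cong (p ⟩∘⟨refl) (q ⟩∘⟨refl)

  ×-id : ∀ {X Q} → id {X} ×₁ id {Q} ≈ id
  ×-id = trans≈ (⟨⟩-cong identityˡ identityˡ) ⟨⟩-η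

  ×∘⟨⟩ : ∀ {f : X ⇒ X'} {g : Q ⇒ Q'} {h : W ⇒ X} {k : W ⇒ Q} → (f ×₁ g) ∘ ⟨ h , k ⟩ ≈ ⟨ f ∘ h , g ∘ k ⟩
  ×∘⟨⟩ = trans≈ ⟨⟩∘ (⟨⟩-cong (pullʳ π₁-β) (pullʳ π₂-β))

  ×id∘⟨⟩ : ∀ {f : X ⇒ X'} {h : W ⇒ X} {k : W ⇒ Q} → (f ×₁ id) ∘ ⟨ h , k ⟩ ≈ ⟨ f ∘ h , k ⟩
  ×id∘⟨⟩ = trans≈ ×∘⟨⟩ (⟨⟩-cong refl≈ identityˡ)

  id×∘⟨⟩ : ∀ {g : Q ⇒ Q'} {h : W ⇒ X} {k : W ⇒ Q} → (id ×₁ g) ∘ ⟨ h , k ⟩ ≈ ⟨ h , g ∘ k ⟩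
  id×∘⟨⟩ = trans≈ ×∘⟨⟩ (⟨⟩-cong identityˡ refl≈)

  ×∘× : ∀ {f : X ⇒ X'} {g : Q ⇒ Q'} {h : A ⇒ X} {k : B ⇒ Q} → (f ×₁ g) ∘ (h ×₁ k) ≈ (f ∘ h) ×₁ (g ∘ k)
  ×∘× = trans≈ ×∘⟨⟩ (⟨⟩-cong sym-assoc sym-assoc)

  ×id∘×id : ∀ {f : X ⇒ X'} {h : A ⇒ X} → (f ×₁ id {Q}) ∘ (h ×₁ id) ≈ (f ∘ h) ×₁ id
  ×id∘×id = trans≈ ×∘× (×-cong refl≈ identityˡ)

  ×id-square : ∀ {w : A ⇒ B} {w' : X ⇒ X'} {a : X ⇒ A} {b : X' ⇒ B} →
               w ∘ a ≈ b ∘ w' → (w ×₁ id {Q}) ∘ (a ×₁ id) ≈ (b ×₁ id) ∘ (w' ×₁ id)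
  ×id-square p = trans≈ ×id∘×id (sym≈ (trans≈ ×id∘×id (×-cong (sym≈ p) refl≈)))

  ×-interchange : ∀ {f : X ⇒ X'} {g : Q ⇒ Q'} → (f ×₁ id) ∘ (id ×₁ g) ≈ (id ×₁ g) ∘ (f ×₁ id)
  ×-interchange = trans≈ ×∘× (trans≈ (×-cong (trans≈ identityʳ (sym≈ identityˡ)) (trans≈ identityˡ (sym≈ identityʳ)))
                                     (sym≈ ×∘×))

  π₁∘π₂-natural : ∀ {h : X ⇒ X'} {f : A ⇒ A'} {g : B ⇒ Q} → (π₁ ∘ π₂) ∘ (h ×₁ (f ×₁ g)) ≈ f ∘ π₁ ∘ π₂
  π₁∘π₂-natural = trans≈ (pullʳ π₂-β) (trans≈ sym-assoc (trans≈ (π₁-β ⟩∘⟨refl) assoc))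

  π₁∘π₂∘×id : ∀ {h : X ⇒ X'} → (π₁ ∘ π₂) ∘ (h ×₁ id {A × B}) ≈ π₁ ∘ π₂
  π₁∘π₂∘×id = pullʳ (trans≈ π₂-β identityˡ)

  swap∘⟨⟩ : ∀ {f : W ⇒ X} {g : W ⇒ Q} → swap ∘ ⟨ f , g ⟩ ≈ ⟨ g , f ⟩
  swap∘⟨⟩ = trans≈ ⟨⟩∘ (⟨⟩-cong π₂-β π₁-β)

  swap∘swap : ∀ {X Q} → swap {X} {Q} ∘ swap ≈ id
  swap∘swap = trans≈ swap∘⟨⟩ ⟨⟩-η

  swap∘× : ∀ {f : X ⇒ X'} {g : Q ⇒ Q'} → swap ∘ (f ×₁ g) ≈ (g ×₁ f) ∘ swap
  swap∘× = trans≈ swap∘⟨⟩ (sym≈ ×∘⟨⟩)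

  α∘⟨⟨⟩⟩ : ∀ {a : W ⇒ A} {b : W ⇒ B} {c : W ⇒ Q} → α ∘ ⟨ ⟨ a , b ⟩ , c ⟩ ≈ ⟨ a , ⟨ b , c ⟩ ⟩
  α∘⟨⟨⟩⟩ = trans≈ ⟨⟩∘ (⟨⟩-cong (trans≈ assoc (trans≈ (refl⟩∘⟨ π₁-β) π₁-β))
                              (trans≈ ⟨⟩∘ (⟨⟩-cong (trans≈ assoc (trans≈ (refl⟩∘⟨ π₁-β) π₂-β)) π₂-β)))

  α⁻¹∘⟨⟨⟩⟩ : ∀ {a : W ⇒ A} {b : W ⇒ B} {c : W ⇒ Q} → α⁻¹ ∘ ⟨ a , ⟨ b , c ⟩ ⟩ ≈ ⟨ ⟨ a , b ⟩ , c ⟩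
  α⁻¹∘⟨⟨⟩⟩ = trans≈ ⟨⟩∘ (⟨⟩-cong (trans≈ ⟨⟩∘ (⟨⟩-cong π₁-β (trans≈ assoc (trans≈ (refl⟩∘⟨ π₂-β) π₁-β))))
                                  (trans≈ assoc (trans≈ (refl⟩∘⟨ π₂-β) π₂-β)))

  α∘α⁻¹ : ∀ {X Y Q} → α {X} {Y} {Q} ∘ α⁻¹ ≈ id
  α∘α⁻¹ = trans≈ α∘⟨⟨⟩⟩ (trans≈ (⟨⟩-cong refl≈ (sym≈ ⟨π₁∘,π₂∘⟩)) ⟨⟩-η)

  α⁻¹∘α : ∀ {X Y Q} → α⁻¹ {X} {Y} {Q} ∘ α ≈ id
  α⁻¹∘α = trans≈ α⁻¹∘⟨⟨⟩⟩ (trans≈ (⟨⟩-cong (sym≈ ⟨π₁∘,π₂∘⟩) refl≈) ⟨⟩-η)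

  α-natural : ∀ {f : X ⇒ X'} {g : Q ⇒ Q'} {h : A ⇒ B} → α ∘ ((f ×₁ g) ×₁ h) ≈ (f ×₁ (g ×₁ h)) ∘ α
  α-natural = begin
    α ∘ ((_ ×₁ _) ×₁ _)                            ≈⟨ refl⟩∘⟨ ⟨⟩-cong (trans≈ ⟨⟩∘ (⟨⟩-cong assoc assoc)) refl≈ ⟩
    α ∘ ⟨ ⟨ _ ∘ π₁ ∘ π₁ , _ ∘ π₂ ∘ π₁ ⟩ , _ ∘ π₂ ⟩  ≈⟨ α∘⟨⟨⟩⟩ ⟩
    ⟨ _ ∘ π₁ ∘ π₁ , ⟨ _ ∘ π₂ ∘ π₁ , _ ∘ π₂ ⟩ ⟩      ≈⟨ trans≈ ×∘⟨⟩ (⟨⟩-cong refl≈ ×∘⟨⟩) ⟨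
    (_ ×₁ (_ ×₁ _)) ∘ α                            ∎

  α⁻¹-natural : ∀ {f : X ⇒ X'} {g : Q ⇒ Q'} {h : A ⇒ B} → α⁻¹ ∘ (f ×₁ (g ×₁ h)) ≈ ((f ×₁ g) ×₁ h) ∘ α⁻¹
  α⁻¹-natural = begin
    α⁻¹ ∘ (_ ×₁ (_ ×₁ _))                            ≈⟨ refl⟩∘⟨ ⟨⟩-cong refl≈ (trans≈ ⟨⟩∘ (⟨⟩-cong assoc assoc)) ⟩
    α⁻¹ ∘ ⟨ _ ∘ π₁ , ⟨ _ ∘ π₁ ∘ π₂ , _ ∘ π₂ ∘ π₂ ⟩ ⟩  ≈⟨ α⁻¹∘⟨⟨⟩⟩ ⟩
    ⟨ ⟨ _ ∘ π₁ , _ ∘ π₁ ∘ π₂ ⟩ , _ ∘ π₂ ∘ π₂ ⟩        ≈⟨ trans≈ ×∘⟨⟩ (⟨⟩-cong ×∘⟨⟩ refl≈) ⟨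
    ((_ ×₁ _) ×₁ _) ∘ α⁻¹                            ∎

  []-cong : ∀ {f f' : X ⇒ W} {g g' : Q ⇒ W} → f ≈ f' → g ≈ g' → [ f , g ] ≈ [ f' , g' ]
  []-cong p q = []-unique (trans≈ ι₁-β p) (trans≈ ι₂-β q)

  +-ext : ∀ {f g : X + Q ⇒ W} → f ∘ ι₁ ≈ g ∘ ι₁ → f ∘ ι₂ ≈ g ∘ ι₂ → f ≈ g
  +-ext p q = trans≈ ([]-unique p q) (sym≈ ([]-unique refl≈ refl≈))

  ∘[] : ∀ {f : X ⇒ W} {g : Q ⇒ W} {h : W ⇒ V} → h ∘ [ f , g ] ≈ [ h ∘ f , h ∘ g ]
  ∘[] = []-unique (pullʳ ι₁-β) (pullʳ ι₂-β)

  +-cong : ∀ {f f' : X ⇒ X'} {g g' : Q ⇒ Q'} → f ≈ f' → g ≈ g' → f +₁ g ≈ f' +₁ g'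
  +-cong p q = []-cong (refl⟩∘⟨ p) (refl⟩∘⟨ q)

  +-id : ∀ {X Q} → id {X} +₁ id {Q} ≈ id
  +-id = trans≈ ([]-cong identityʳ identityʳ) (sym≈ ([]-unique identityˡ identityˡ))

  +∘+ : ∀ {f : X ⇒ X'} {g : Q ⇒ Q'} {h : A ⇒ X} {k : B ⇒ Q} → (f +₁ g) ∘ (h +₁ k) ≈ (f ∘ h) +₁ (g ∘ k)
  +∘+ = trans≈ ∘[] ([]-cong (trans≈ (pullˡ ι₁-β) assoc) (trans≈ (pullˡ ι₂-β) assoc))

  curry-β′ : ∀ {f : W × Q ⇒ X} → ev ∘ (curry f ×₁ id) ≈ f
  curry-β′ = trans≈ (refl⟩∘⟨ ⟨⟩-cong refl≈ identityˡ) curry-β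

  curry-unique′ : ∀ {f : W × Q ⇒ X} {h : W ⇒ X ^ Q} → ev ∘ (h ×₁ id) ≈ f → h ≈ curry f
  curry-unique′ p = curry-unique (trans≈ (refl⟩∘⟨ ⟨⟩-cong refl≈ (sym≈ identityˡ)) p)

  curry-cong : ∀ {f g : W × Q ⇒ X} → f ≈ g → curry f ≈ curry g
  curry-cong p = curry-unique (trans≈ curry-β p)

  curry-injective : ∀ {f g : W × Q ⇒ X} → curry f ≈ curry g → f ≈ g
  curry-injective p = trans≈ (sym≈ curry-β′) (trans≈ (refl⟩∘⟨ ×-cong p refl≈) curry-β′)

  curry-ev : ∀ {X Q} → curry (ev {X} {Q}) ≈ id
  curry-ev = sym≈ (curry-unique′ (elimʳ ×-id))

  curry∘ : ∀ {f : W × Q ⇒ X} {h : V ⇒ W} → curry f ∘ h ≈ curry (f ∘ (h ×₁ id))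
  curry∘ = curry-unique′ (trans≈ (refl⟩∘⟨ sym≈ ×id∘×id) (pullˡ curry-β′))

  uncurry-cong : ∀ {f g : W ⇒ X ^ Q} → f ≈ g → uncurry f ≈ uncurry g
  uncurry-cong p = refl⟩∘⟨ ×-cong p refl≈

  uncurry∘ : ∀ {f : W ⇒ X ^ Q} {h : V ⇒ W} → uncurry (f ∘ h) ≈ uncurry f ∘ (h ×₁ id)
  uncurry∘ = trans≈ (refl⟩∘⟨ sym≈ ×id∘×id) sym-assoc

  uncurry-curry∘ : ∀ {f : W × Q ⇒ X} {h : V ⇒ W} → uncurry (curry f ∘ h) ≈ f ∘ (h ×₁ id)
  uncurry-curry∘ = trans≈ uncurry∘ (curry-β′ ⟩∘⟨refl)

  uncurry∘⟨⟩ : ∀ {g : W ⇒ A ^ B} {a : V ⇒ W} {b : V ⇒ B} → uncurry g ∘ ⟨ a , b ⟩ ≈ ev ∘ ⟨ g ∘ a , b ⟩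
  uncurry∘⟨⟩ = trans≈ assoc (refl⟩∘⟨ ×id∘⟨⟩)

  expMap-cong : ∀ {f f' : X ⇒ X'} {g g' : Q' ⇒ Q} → f ≈ f' → g ≈ g' → expMap f g ≈ expMap f' g'
  expMap-cong p q = curry-cong (p ⟩∘⟨ refl⟩∘⟨ ×-cong refl≈ q)

  expMap-id : ∀ {X Q} → expMap (id {X}) (id {Q}) ≈ id
  expMap-id = trans≈ (curry-cong (trans≈ identityˡ (elimʳ ×-id))) curry-ev

  expMap-∘ : ∀ {X'' Q''} {f : X' ⇒ X''} {g : Q'' ⇒ Q'} {f' : X ⇒ X'} {g' : Q' ⇒ Q} →
             expMap f g ∘ expMap f' g' ≈ expMap (f ∘ f') (g' ∘ g)
  expMap-∘ {f = f} {g} {f'} {g'} = begin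
    expMap f g ∘ expMap f' g'
      ≈⟨ curry∘ ⟩
    curry ((f ∘ ev ∘ (id ×₁ g)) ∘ (expMap f' g' ×₁ id))
      ≈⟨ curry-cong (trans≈ assoc² (refl⟩∘⟨ refl⟩∘⟨ sym≈ ×-interchange)) ⟩
    curry (f ∘ ev ∘ (expMap f' g' ×₁ id) ∘ (id ×₁ g))
      ≈⟨ curry-cong (refl⟩∘⟨ pullˡ curry-β′) ⟩
    curry (f ∘ (f' ∘ ev ∘ (id ×₁ g')) ∘ (id ×₁ g))
      ≈⟨ curry-cong (trans≈ (refl⟩∘⟨ trans≈ assoc² (refl⟩∘⟨ refl⟩∘⟨ trans≈ ×∘× (×-cong identityˡ refl≈))) sym-assoc) ⟩
    curry ((f ∘ f') ∘ ev ∘ (id ×₁ (g' ∘ g))) ∎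

  curryIso⁻¹∘curryIso : ∀ {Z Y V} → curryIso⁻¹ {Z} {Y} {V} ∘ curryIso ≈ id
  curryIso⁻¹∘curryIso = trans≈ (curry-unique′ ev∘) curry-ev
    where
      ev∘ : ev ∘ ((curryIso⁻¹ ∘ curryIso) ×₁ id) ≈ ev
      ev∘ = begin
        ev ∘ ((curryIso⁻¹ ∘ curryIso) ×₁ id)
          ≈⟨ refl⟩∘⟨ sym≈ ×id∘×id ⟩
        ev ∘ (curryIso⁻¹ ×₁ id) ∘ (curryIso ×₁ id)
          ≈⟨ pullˡ curry-β′ ⟩
        curry (ev ∘ α) ∘ (curryIso ×₁ id)
          ≈⟨ curry∘ ⟩
        curry ((ev ∘ α) ∘ ((curryIso ×₁ id) ×₁ id))
          ≈⟨ curry-cong (trans≈ (pullʳ α-natural) (refl⟩∘⟨ (×-cong refl≈ ×-id ⟩∘⟨refl))) ⟩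
        curry (ev ∘ (curryIso ×₁ id) ∘ α)
          ≈⟨ curry-cong (pullˡ curry-β′) ⟩
        curry ((ev ∘ (ev ×₁ id) ∘ α⁻¹) ∘ α)
          ≈⟨ curry-cong (trans≈ assoc² (refl⟩∘⟨ elimʳ α⁻¹∘α)) ⟩
        curry (ev ∘ (ev ×₁ id))
          ≈⟨ curry-unique′ refl≈ ⟨
        ev ∎

  curryIso∘curryIso⁻¹ : ∀ {Z Y V} → curryIso {Z} {Y} {V} ∘ curryIso⁻¹ ≈ id
  curryIso∘curryIso⁻¹ = trans≈ (curry-unique′ ev∘) curry-ev
    where
      ev∘ : ev ∘ ((curryIso ∘ curryIso⁻¹) ×₁ id) ≈ ev
      ev∘ = begin
        ev ∘ ((curryIso ∘ curryIso⁻¹) ×₁ id)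
          ≈⟨ refl⟩∘⟨ sym≈ ×id∘×id ⟩
        ev ∘ (curryIso ×₁ id) ∘ (curryIso⁻¹ ×₁ id)
          ≈⟨ pullˡ curry-β′ ⟩
        (ev ∘ (ev ×₁ id) ∘ α⁻¹) ∘ (curryIso⁻¹ ×₁ id)
          ≈⟨ trans≈ assoc² (refl⟩∘⟨ refl⟩∘⟨ trans≈ (refl⟩∘⟨ ×-cong refl≈ (sym≈ ×-id)) α⁻¹-natural) ⟩
        ev ∘ (ev ×₁ id) ∘ ((curryIso⁻¹ ×₁ id) ×₁ id) ∘ α⁻¹
          ≈⟨ refl⟩∘⟨ pullˡ (trans≈ ×id∘×id (×-cong curry-β′ refl≈)) ⟩
        ev ∘ (curry (ev ∘ α) ×₁ id) ∘ α⁻¹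
          ≈⟨ pullˡ curry-β′ ⟩
        (ev ∘ α) ∘ α⁻¹
          ≈⟨ trans≈ assoc (elimʳ α∘α⁻¹) ⟩
        ev ∎

  -- (A + B) × X is a coproduct because - × X has a right adjoint
  +×-ext : ∀ {p q : (A + B) × X ⇒ W} →
           p ∘ (ι₁ ×₁ id) ≈ q ∘ (ι₁ ×₁ id) → p ∘ (ι₂ ×₁ id) ≈ q ∘ (ι₂ ×₁ id) → p ≈ q
  +×-ext h₁ h₂ = curry-injective (+-ext (curried h₁) (curried h₂))
    where
      curried : ∀ {p q : (A + B) × X ⇒ W} {ι : Q ⇒ A + B} → p ∘ (ι ×₁ id) ≈ q ∘ (ι ×₁ id) →
                curry p ∘ ι ≈ curry q ∘ ι
      curried h = trans≈ curry∘ (trans≈ (curry-cong h) (sym≈ curry∘))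

  ×+-ext : ∀ {p q : X × (A + B) ⇒ W} →
           p ∘ (id ×₁ ι₁) ≈ q ∘ (id ×₁ ι₁) → p ∘ (id ×₁ ι₂) ≈ q ∘ (id ×₁ ι₂) → p ≈ q
  ×+-ext h₁ h₂ = split-epi-cancelʳ swap∘swap (+×-ext (restricted h₁) (restricted h₂))
    where
      restricted : ∀ {p q : X × (A + B) ⇒ W} {ι : Q ⇒ A + B} → p ∘ (id ×₁ ι) ≈ q ∘ (id ×₁ ι) →
                   (p ∘ swap) ∘ (ι ×₁ id) ≈ (q ∘ swap) ∘ (ι ×₁ id)
      restricted h = trans≈ (pullʳ swap∘×) (trans≈ sym-assoc (trans≈ (h ⟩∘⟨refl) (trans≈ assoc (sym≈ (pullʳ swap∘×)))))

  dist-restrict : ∀ {ι : Q ⇒ A + B} {j : X × Q ⇒ (X × A) + (X × B)} →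
                  [ curry (ι₁ ∘ swap) , curry (ι₂ ∘ swap) ] ∘ ι ≈ curry (j ∘ swap) → dist ∘ (id ×₁ ι) ≈ j
  dist-restrict p = begin
    dist ∘ (id ×₁ _)                        ≈⟨ pullʳ swap∘× ⟩
    uncurry _ ∘ (_ ×₁ id) ∘ swap            ≈⟨ pullˡ (trans≈ (sym≈ uncurry∘) (trans≈ (uncurry-cong p) curry-β′)) ⟩
    (_ ∘ swap) ∘ swap                       ≈⟨ trans≈ assoc (elimʳ swap∘swap) ⟩
    _                                       ∎

  dist-ι₁ : dist {X} {A} {B} ∘ (id ×₁ ι₁) ≈ ι₁
  dist-ι₁ = dist-restrict ι₁-β

  dist-ι₂ : dist {X} {A} {B} ∘ (id ×₁ ι₂) ≈ ι₂
  dist-ι₂ = dist-restrict ι₂-β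

  []∘dist-ι₁ : ∀ {f : X × A ⇒ W} {g : X × B ⇒ W} → ([ f , g ] ∘ dist) ∘ (id ×₁ ι₁) ≈ f
  []∘dist-ι₁ = trans≈ (pullʳ dist-ι₁) ι₁-β

  []∘dist-ι₂ : ∀ {f : X × A ⇒ W} {g : X × B ⇒ W} → ([ f , g ] ∘ dist) ∘ (id ×₁ ι₂) ≈ g
  []∘dist-ι₂ = trans≈ (pullʳ dist-ι₂) ι₂-β

  dist-natural : ∀ {h : X ⇒ X'} → dist {X'} {A} {B} ∘ (h ×₁ id) ≈ ((h ×₁ id) +₁ (h ×₁ id)) ∘ dist
  dist-natural =
    ×+-ext (trans≈ (pullʳ ×-interchange) (trans≈ (pullˡ dist-ι₁) (sym≈ (trans≈ (pullʳ dist-ι₁) ι₁-β))))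
           (trans≈ (pullʳ ×-interchange) (trans≈ (pullˡ dist-ι₂) (sym≈ (trans≈ (pullʳ dist-ι₂) ι₂-β))))

  distʳ : (A + B) × X ⇒ (A × X) + (B × X)
  distʳ = (swap +₁ swap) ∘ dist ∘ swap

  distʳ-restrict : ∀ {ι : Q ⇒ A + B} {ι' : X × Q ⇒ (X × A) + (X × B)} {ι'' : Q × X ⇒ (A × X) + (B × X)} →
                   dist ∘ (id ×₁ ι) ≈ ι' → (swap +₁ swap) ∘ ι' ≈ ι'' ∘ swap → distʳ ∘ (ι ×₁ id) ≈ ι''
  distʳ-restrict p q = begin
    distʳ ∘ (_ ×₁ id)                        ≈⟨ trans≈ assoc² (refl⟩∘⟨ refl⟩∘⟨ swap∘×) ⟩
    (swap +₁ swap) ∘ dist ∘ (id ×₁ _) ∘ swap ≈⟨ refl⟩∘⟨ pullˡ p ⟩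
    (swap +₁ swap) ∘ _ ∘ swap                ≈⟨ pullˡ q ⟩
    (_ ∘ swap) ∘ swap                        ≈⟨ trans≈ assoc (elimʳ swap∘swap) ⟩
    _                                        ∎

  distʳ-ι₁ : distʳ {A} {B} {X} ∘ (ι₁ ×₁ id) ≈ ι₁
  distʳ-ι₁ = distʳ-restrict dist-ι₁ ι₁-β

  distʳ-ι₂ : distʳ {A} {B} {X} ∘ (ι₂ ×₁ id) ≈ ι₂
  distʳ-ι₂ = distʳ-restrict dist-ι₂ ι₂-β

  id×∘id×∘id× : ∀ {a : A ⇒ B} {b : D ⇒ A} {c : Q ⇒ D} → (id {X} ×₁ a) ∘ (id ×₁ b) ∘ (id ×₁ c) ≈ id ×₁ (a ∘ b ∘ c)
  id×∘id×∘id× = trans≈ (refl⟩∘⟨ ×∘×) (trans≈ ×∘× (×-cong (trans≈ identityˡ identityˡ) refl≈))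

  exchange : X × (A × B) ⇒ A × (X × B)
  exchange = ⟨ π₁ ∘ π₂ , ⟨ π₁ , π₂ ∘ π₂ ⟩ ⟩

  exchange∘exchange : exchange ∘ exchange {X} {A} {B} ≈ id
  exchange∘exchange = begin
    exchange ∘ exchange
      ≈⟨ ⟨⟩∘ ⟩
    ⟨ _ , ⟨ π₁ , π₂ ∘ π₂ ⟩ ∘ exchange ⟩
      ≈⟨ ⟨⟩-cong (trans≈ (pullʳ π₂-β) π₁-β) (trans≈ ⟨⟩∘ (⟨⟩-cong π₁-β (trans≈ (pullʳ π₂-β) π₂-β))) ⟩
    ⟨ π₁ , ⟨ π₁ ∘ π₂ , π₂ ∘ π₂ ⟩ ⟩
      ≈⟨ trans≈ (⟨⟩-cong refl≈ (sym≈ ⟨π₁∘,π₂∘⟩)) ⟨⟩-η ⟩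
    id ∎

  exchange-natural : ∀ {f : A ⇒ A'} → exchange ∘ (f ×₁ id {X × B}) ≈ (id ×₁ (f ×₁ id)) ∘ exchange
  exchange-natural {f = f} = begin
    exchange ∘ (f ×₁ id)                        ≈⟨ ⟨⟩∘ ⟩
    ⟨ (π₁ ∘ π₂) ∘ (f ×₁ id) , _ ⟩               ≈⟨ ⟨⟩-cong (pullʳ (trans≈ π₂-β identityˡ))
                                                             (trans≈ ⟨⟩∘ (⟨⟩-cong π₁-β (pullʳ (trans≈ π₂-β identityˡ)))) ⟩
    ⟨ π₁ ∘ π₂ , ⟨ f ∘ π₁ , π₂ ∘ π₂ ⟩ ⟩          ≈⟨ trans≈ id×∘⟨⟩ (⟨⟩-cong refl≈ ×id∘⟨⟩) ⟨
    (id ×₁ (f ×₁ id)) ∘ exchange                ∎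

  case-ext : ∀ {p q : X × ((A + B) × Q) ⇒ W} →
             p ∘ (id ×₁ (ι₁ ×₁ id)) ≈ q ∘ (id ×₁ (ι₁ ×₁ id)) →
             p ∘ (id ×₁ (ι₂ ×₁ id)) ≈ q ∘ (id ×₁ (ι₂ ×₁ id)) → p ≈ q
  case-ext h₁ h₂ = split-epi-cancelʳ exchange∘exchange (+×-ext (restricted h₁) (restricted h₂))
    where
      restrict : ∀ {p : X × ((A + B) × Q) ⇒ W} {ι : A' ⇒ A + B} →
                 (p ∘ exchange) ∘ (ι ×₁ id) ≈ (p ∘ (id ×₁ (ι ×₁ id))) ∘ exchange
      restrict = trans≈ (pullʳ exchange-natural) sym-assoc
      restricted : ∀ {p q : X × ((A + B) × Q) ⇒ W} {ι : A' ⇒ A + B} →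
                   p ∘ (id ×₁ (ι ×₁ id)) ≈ q ∘ (id ×₁ (ι ×₁ id)) →
                   (p ∘ exchange) ∘ (ι ×₁ id) ≈ (q ∘ exchange) ∘ (ι ×₁ id)
      restricted h = trans≈ restrict (trans≈ (h ⟩∘⟨refl) (sym≈ restrict))

  idCast : X ≡ X' → X ⇒ X'
  idCast e = cast refl e id

  ×-idCast : (e₁ : X ≡ X') (e₂ : Q ≡ Q') → idCast e₁ ×₁ idCast e₂ ≈ idCast (cong₂ _×_ e₁ e₂)
  ×-idCast refl refl = ×-id

  +-idCast : (e₁ : X ≡ X') (e₂ : Q ≡ Q') → idCast e₁ +₁ idCast e₂ ≈ idCast (cong₂ _+_ e₁ e₂)
  +-idCast refl refl = +-id

  idCast∘idCast-sym : (e : X ≡ X') → idCast e ∘ idCast (sym e) ≈ id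
  idCast∘idCast-sym refl = identityˡ

  ∘idCast×id : (e : X ≡ X') (f : X' × Q ⇒ W) → f ∘ (idCast e ×₁ id) ≈ cast (cong (_× Q) (sym e)) refl f
  ∘idCast×id refl f = elimʳ ×-id

  cast-transpose : (e : X ≡ X') {f : X' × Q ⇒ W} {w : X × Q ⇒ W} →
                   w ≈ f ∘ (idCast e ×₁ id) → f ≈ cast (cong (_× Q) e) refl w
  cast-transpose refl p = sym≈ (trans≈ p (elimʳ ×-id))

  cast×id-square : (e₁ : X ≡ X') (e₂ : Q ≡ Q') (f : X × W ⇒ Q × W) →
                   cast (cong (_× W) e₁) (cong (_× W) e₂) f ∘ (idCast e₁ ×₁ id) ≈ (idCast e₂ ×₁ id) ∘ f
  cast×id-square refl refl f = trans≈ (elimʳ ×-id) (sym≈ (elimˡ ×-id))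

module StrongMonadProperties {o ℓ e} (C : BCCC o ℓ e) (T : StrongMonad C) where
  open BCCC C
  open BCCCProperties C
  open StrongMonad T
  open IsStrongMonad isStrongMonad public

  private
    variable
      A B D X X' Q W V : Obj

  F₁∘η : ∀ {w : X ⇒ Q} → F₁ w ∘ η ≈ η ∘ w
  F₁∘η = sym≈ η-nat

  F₁∘η∘ : ∀ {w : B ⇒ D} {x : A ⇒ B} → F₁ w ∘ η ∘ x ≈ η ∘ w ∘ x
  F₁∘η∘ = trans≈ (pullˡ F₁∘η) assoc

  F-fuse : ∀ {f : X ⇒ Q} {g : Q ⇒ W} {h : V ⇒ F₀ X} → F₁ g ∘ F₁ f ∘ h ≈ F₁ (g ∘ f) ∘ h
  F-fuse = pullˡ (sym≈ F-∘)

  F-fuse₃ : ∀ {A B C' D' E} {a : D' ⇒ E} {b : C' ⇒ D'} {c : B ⇒ C'} {x : A ⇒ F₀ B} →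
            F₁ a ∘ F₁ b ∘ F₁ c ∘ x ≈ F₁ (a ∘ b ∘ c) ∘ x
  F-fuse₃ = trans≈ (refl⟩∘⟨ F-fuse) F-fuse

  F-fuse₄ : ∀ {A B C' D' E F'} {a : E ⇒ F'} {b : D' ⇒ E} {c : C' ⇒ D'} {d : B ⇒ C'} {x : A ⇒ F₀ B} →
            F₁ a ∘ F₁ b ∘ F₁ c ∘ F₁ d ∘ x ≈ F₁ (a ∘ b ∘ c ∘ d) ∘ x
  F-fuse₄ = trans≈ (refl⟩∘⟨ F-fuse₃) F-fuse

  F-fuse₅ : ∀ {A B C' D' E F' G'} {a : F' ⇒ G'} {b : E ⇒ F'} {c : D' ⇒ E} {d : C' ⇒ D'} {d' : B ⇒ C'}
              {x : A ⇒ F₀ B} →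
            F₁ a ∘ F₁ b ∘ F₁ c ∘ F₁ d ∘ F₁ d' ∘ x ≈ F₁ (a ∘ b ∘ c ∘ d ∘ d') ∘ x
  F-fuse₅ = trans≈ (refl⟩∘⟨ F-fuse₄) F-fuse

  F-fuse₆ : ∀ {A B C' D' E F' G' H'} {a : G' ⇒ H'} {b : F' ⇒ G'} {c : E ⇒ F'} {d : D' ⇒ E} {d' : C' ⇒ D'}
              {d'' : B ⇒ C'} {x : A ⇒ F₀ B} →
            F₁ a ∘ F₁ b ∘ F₁ c ∘ F₁ d ∘ F₁ d' ∘ F₁ d'' ∘ x ≈ F₁ (a ∘ b ∘ c ∘ d ∘ d' ∘ d'') ∘ x
  F-fuse₆ = trans≈ (refl⟩∘⟨ F-fuse₅) F-fuse

  st-naturalˡ : ∀ {f : X ⇒ X'} → st {X'} {Q} ∘ (f ×₁ id) ≈ F₁ (f ×₁ id) ∘ st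
  st-naturalˡ = trans≈ (refl⟩∘⟨ ×-cong refl≈ (sym≈ F-id)) st-nat

  F₁π₂∘st : F₁ π₂ ∘ st {X} {Q} ≈ π₂
  F₁π₂∘st = begin
    F₁ π₂ ∘ st                    ≈⟨ trans≈ (F-cong (sym≈ (trans≈ π₂-β identityˡ))) F-∘ ⟩∘⟨refl ⟩
    (F₁ π₂ ∘ F₁ (! ×₁ id)) ∘ st   ≈⟨ pullʳ (sym≈ st-naturalˡ) ⟩
    F₁ π₂ ∘ st ∘ (! ×₁ id)        ≈⟨ pullˡ st-unit ⟩
    π₂ ∘ (! ×₁ id)                ≈⟨ trans≈ π₂-β identityˡ ⟩
    π₂                            ∎

  st∘⟨,η⟩ : ∀ {a : W ⇒ X} {b : W ⇒ Q} → st ∘ ⟨ a , η ∘ b ⟩ ≈ η ∘ ⟨ a , b ⟩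
  st∘⟨,η⟩ = trans≈ (refl⟩∘⟨ sym≈ id×∘⟨⟩) (pullˡ st-η)

  st'∘⟨η,⟩ : ∀ {a : W ⇒ X} {x : W ⇒ F₀ Q} → st' ∘ ⟨ η ∘ a , x ⟩ ≈ η ∘ ⟨ a , x ⟩
  st'∘⟨η,⟩ = begin
    (F₁ swap ∘ st ∘ swap) ∘ ⟨ _ , _ ⟩   ≈⟨ trans≈ assoc² (refl⟩∘⟨ refl⟩∘⟨ swap∘⟨⟩) ⟩
    F₁ swap ∘ st ∘ ⟨ _ , η ∘ _ ⟩        ≈⟨ refl⟩∘⟨ st∘⟨,η⟩ ⟩
    F₁ swap ∘ η ∘ ⟨ _ , _ ⟩             ≈⟨ F₁∘η∘ ⟩
    η ∘ swap ∘ ⟨ _ , _ ⟩                ≈⟨ refl⟩∘⟨ swap∘⟨⟩ ⟩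
    η ∘ ⟨ _ , _ ⟩                       ∎

  μ∘η∘ : ∀ {f : X ⇒ F₀ Q} → μ ∘ η ∘ f ≈ f
  μ∘η∘ = trans≈ (pullˡ μ-ηˡ) identityˡ

  μ∘F₁η∘ : ∀ {f : X ⇒ F₀ Q} → μ ∘ F₁ η ∘ f ≈ f
  μ∘F₁η∘ = trans≈ (pullˡ μ-ηʳ) identityˡ

  -- the interpretation of  let x = m in k  in a context X
  bind : X × A ⇒ F₀ B → X ⇒ F₀ A → X ⇒ F₀ B
  bind k m = μ ∘ F₁ k ∘ st ∘ ⟨ id , m ⟩

  bind-cong : ∀ {k k' : X × A ⇒ F₀ B} {m m' : X ⇒ F₀ A} → k ≈ k' → m ≈ m' → bind k m ≈ bind k' m'
  bind-cong p q = refl⟩∘⟨ F-cong p ⟩∘⟨ refl⟩∘⟨ ⟨⟩-cong refl≈ q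

  μ∘F₁∘st∘⟨⟩ : ∀ {k : X × A ⇒ F₀ B} {a : W ⇒ X} {n : W ⇒ F₀ A} →
               μ ∘ F₁ k ∘ st ∘ ⟨ a , n ⟩ ≈ bind (k ∘ (a ×₁ id)) n
  μ∘F₁∘st∘⟨⟩ {k = k} {a} {n} = begin
    μ ∘ F₁ k ∘ st ∘ ⟨ a , n ⟩
      ≈⟨ refl⟩∘⟨ refl⟩∘⟨ refl⟩∘⟨ sym≈ (trans≈ ×∘⟨⟩ (⟨⟩-cong identityʳ identityˡ)) ⟩
    μ ∘ F₁ k ∘ st ∘ (a ×₁ id) ∘ ⟨ id , n ⟩
      ≈⟨ refl⟩∘⟨ refl⟩∘⟨ pullˡ st-naturalˡ ⟩
    μ ∘ F₁ k ∘ (F₁ (a ×₁ id) ∘ st) ∘ ⟨ id , n ⟩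
      ≈⟨ refl⟩∘⟨ trans≈ (refl⟩∘⟨ assoc) F-fuse ⟩
    μ ∘ F₁ (k ∘ (a ×₁ id)) ∘ st ∘ ⟨ id , n ⟩ ∎

  bind-∘ : ∀ {k : X × A ⇒ F₀ B} {m : X ⇒ F₀ A} {h : W ⇒ X} →
           bind k m ∘ h ≈ bind (k ∘ (h ×₁ id)) (m ∘ h)
  bind-∘ = trans≈ assoc³ (trans≈ (refl⟩∘⟨ refl⟩∘⟨ refl⟩∘⟨ trans≈ ⟨⟩∘ (⟨⟩-cong identityˡ refl≈)) μ∘F₁∘st∘⟨⟩)

  F₁∘bind : ∀ {k : X × A ⇒ F₀ B} {m : X ⇒ F₀ A} {f : B ⇒ D} → F₁ f ∘ bind k m ≈ bind (F₁ f ∘ k) m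
  F₁∘bind = trans≈ (pullˡ (sym≈ μ-nat)) (pullʳ F-fuse)

  bind-F₁ : ∀ {k : X × A ⇒ F₀ B} {m : X ⇒ F₀ D} {f : D ⇒ A} → bind k (F₁ f ∘ m) ≈ bind (k ∘ (id ×₁ f)) m
  bind-F₁ {k = k} {m} {f} = begin
    μ ∘ F₁ k ∘ st ∘ ⟨ id , F₁ f ∘ m ⟩               ≈⟨ refl⟩∘⟨ refl⟩∘⟨ refl⟩∘⟨ sym≈ id×∘⟨⟩ ⟩
    μ ∘ F₁ k ∘ st ∘ (id ×₁ F₁ f) ∘ ⟨ id , m ⟩       ≈⟨ refl⟩∘⟨ refl⟩∘⟨ pullˡ st-nat ⟩
    μ ∘ F₁ k ∘ (F₁ (id ×₁ f) ∘ st) ∘ ⟨ id , m ⟩     ≈⟨ refl⟩∘⟨ trans≈ (refl⟩∘⟨ assoc) F-fuse ⟩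
    μ ∘ F₁ (k ∘ (id ×₁ f)) ∘ st ∘ ⟨ id , m ⟩        ∎

  bind-η : ∀ {k : X × A ⇒ F₀ B} {a : X ⇒ A} → bind k (η ∘ a) ≈ k ∘ ⟨ id , a ⟩
  bind-η = trans≈ (refl⟩∘⟨ refl⟩∘⟨ st∘⟨,η⟩) (trans≈ (refl⟩∘⟨ F₁∘η∘) μ∘η∘)

  bind-return : ∀ {w : A ⇒ B} {m : X ⇒ F₀ A} → bind (η ∘ w ∘ π₂) m ≈ F₁ w ∘ m
  bind-return {w = w} {m} = begin
    μ ∘ F₁ (η ∘ w ∘ π₂) ∘ st ∘ ⟨ id , m ⟩            ≈⟨ refl⟩∘⟨ trans≈ F-∘ (refl⟩∘⟨ F-∘) ⟩∘⟨refl ⟩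
    μ ∘ (F₁ η ∘ F₁ w ∘ F₁ π₂) ∘ st ∘ ⟨ id , m ⟩      ≈⟨ refl⟩∘⟨ trans≈ assoc² (refl⟩∘⟨ refl⟩∘⟨ pullˡ F₁π₂∘st) ⟩
    μ ∘ F₁ η ∘ F₁ w ∘ π₂ ∘ ⟨ id , m ⟩                ≈⟨ trans≈ μ∘F₁η∘ (refl⟩∘⟨ π₂-β) ⟩
    F₁ w ∘ m                                         ∎

  pairing-valueˡ : ∀ {a : W ⇒ X} {x : W ⇒ F₀ Q} → μ ∘ F₁ st ∘ st' ∘ ⟨ η ∘ a , x ⟩ ≈ st ∘ ⟨ a , x ⟩
  pairing-valueˡ = trans≈ (refl⟩∘⟨ refl⟩∘⟨ st'∘⟨η,⟩) (trans≈ (refl⟩∘⟨ F₁∘η∘) μ∘η∘)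

  pairing-values : ∀ {a : W ⇒ X} {b : W ⇒ Q} → μ ∘ F₁ st ∘ st' ∘ ⟨ η ∘ a , η ∘ b ⟩ ≈ η ∘ ⟨ a , b ⟩
  pairing-values = trans≈ pairing-valueˡ st∘⟨,η⟩

  application-value : ∀ {c : W ⇒ F₀ B ^ A} {n : W ⇒ F₀ A} →
                      μ ∘ F₁ μ ∘ F₁ (F₁ ev) ∘ F₁ st ∘ st' ∘ ⟨ η ∘ c , n ⟩ ≈ bind (ev ∘ (c ×₁ id)) n
  application-value {c = c} {n} = begin
    μ ∘ F₁ μ ∘ F₁ (F₁ ev) ∘ F₁ st ∘ st' ∘ ⟨ η ∘ c , n ⟩   ≈⟨ refl⟩∘⟨ refl⟩∘⟨ refl⟩∘⟨ refl⟩∘⟨ st'∘⟨η,⟩ ⟩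
    μ ∘ F₁ μ ∘ F₁ (F₁ ev) ∘ F₁ st ∘ η ∘ ⟨ c , n ⟩         ≈⟨ refl⟩∘⟨ refl⟩∘⟨ refl⟩∘⟨ F₁∘η∘ ⟩
    μ ∘ F₁ μ ∘ F₁ (F₁ ev) ∘ η ∘ st ∘ ⟨ c , n ⟩            ≈⟨ refl⟩∘⟨ refl⟩∘⟨ F₁∘η∘ ⟩
    μ ∘ F₁ μ ∘ η ∘ F₁ ev ∘ st ∘ ⟨ c , n ⟩                 ≈⟨ refl⟩∘⟨ F₁∘η∘ ⟩
    μ ∘ η ∘ μ ∘ F₁ ev ∘ st ∘ ⟨ c , n ⟩                    ≈⟨ trans≈ μ∘η∘ μ∘F₁∘st∘⟨⟩ ⟩
    bind (ev ∘ (c ×₁ id)) n                               ∎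

  F₁-simulation : ∀ {G G' A A' B B'} {w : A' ⇒ B'} {w' : A ⇒ B} {a : A ⇒ A'} {b : B ⇒ B'}
                    {x : G' ⇒ F₀ A'} {d : G ⇒ F₀ A} {d' : G ⇒ F₀ B} {r : G' ⇒ G} →
                  w ∘ a ≈ b ∘ w' → x ≈ F₁ a ∘ d ∘ r → d' ≈ F₁ w' ∘ d → F₁ w ∘ x ≈ F₁ b ∘ d' ∘ r
  F₁-simulation {w = w} {w'} {a} {b} {x} {d} {d'} {r} p q s = begin
    F₁ w ∘ x               ≈⟨ trans≈ (refl⟩∘⟨ q) F-fuse ⟩
    F₁ (w ∘ a) ∘ d ∘ r     ≈⟨ F-cong p ⟩∘⟨refl ⟩
    F₁ (b ∘ w') ∘ d ∘ r    ≈⟨ F-fuse ⟨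
    F₁ b ∘ F₁ w' ∘ d ∘ r   ≈⟨ refl⟩∘⟨ trans≈ sym-assoc (sym≈ s ⟩∘⟨refl) ⟩
    F₁ b ∘ d' ∘ r          ∎

  μF₁-simulation : ∀ {G G' A A' B B'} {w : A' ⇒ F₀ B'} {w' : A ⇒ F₀ B} {a : A ⇒ A'} {b : B ⇒ B'}
                     {x : G' ⇒ F₀ A'} {d : G ⇒ F₀ A} {d' : G ⇒ F₀ B} {r : G' ⇒ G} →
                   w ∘ a ≈ F₁ b ∘ w' → x ≈ F₁ a ∘ d ∘ r → d' ≈ μ ∘ F₁ w' ∘ d → μ ∘ F₁ w ∘ x ≈ F₁ b ∘ d' ∘ r
  μF₁-simulation {w' = w'} {b = b} {d = d} {d'} {r} p q s = begin
    μ ∘ _                        ≈⟨ refl⟩∘⟨ F₁-simulation p q refl≈ ⟩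
    μ ∘ F₁ (F₁ b) ∘ (F₁ w' ∘ d) ∘ r ≈⟨ pullˡ μ-nat ⟩
    (F₁ b ∘ μ) ∘ (F₁ w' ∘ d) ∘ r ≈⟨ trans≈ assoc (refl⟩∘⟨ trans≈ sym-assoc (sym≈ s ⟩∘⟨refl)) ⟩
    F₁ b ∘ d' ∘ r                ∎

module SemanticsProperties {o ℓ e} (C : BCCC o ℓ e) (T : StrongMonad C) {Sig : Signature}
                           (𝒜 : Structure C (StrongMonad.ops T) Sig) where
  open BCCC C
  open BCCCProperties C
  open StrongMonadProperties C T
  open StrongMonad T using (F₀; F₁; η)
  open Semantics C 𝒜

  private
    variable
      A B G G' U : Obj

  ⟨⟩-natural : ∀ {h : G' ⇒ G} {a : G ⇒ A} {b : G ⇒ B} {a' : G' ⇒ A} {b' : G' ⇒ B} →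
               a' ≈ a ∘ h → b' ≈ b ∘ h → ⟨ a' , b' ⟩ ≈ ⟨ a , b ⟩ ∘ h
  ⟨⟩-natural p q = trans≈ (⟨⟩-cong p q) (sym≈ ⟨⟩∘)

  case-natural : ∀ {h : G' ⇒ G} {n₁ : G × A ⇒ F₀ U} {n₂ : G × B ⇒ F₀ U} {m : G ⇒ F₀ (A + B)}
                   {n₁' : G' × A ⇒ F₀ U} {n₂' : G' × B ⇒ F₀ U} {m' : G' ⇒ F₀ (A + B)} →
                 n₁' ≈ n₁ ∘ (h ×₁ id) → n₂' ≈ n₂ ∘ (h ×₁ id) → m' ≈ m ∘ h →
                 bind ([ n₁' , n₂' ] ∘ dist) m' ≈ bind ([ n₁ , n₂ ] ∘ dist) m ∘ h
  case-natural {h = h} {n₁} {n₂} {m} {m' = m'} p₁ p₂ q = sym≈ (begin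
    bind ([ n₁ , n₂ ] ∘ dist) m ∘ h
      ≈⟨ bind-∘ ⟩
    bind (([ n₁ , n₂ ] ∘ dist) ∘ (h ×₁ id)) (m ∘ h)
      ≈⟨ bind-cong (trans≈ (pullʳ dist-natural) (trans≈ sym-assoc (cotuple ⟩∘⟨refl))) (sym≈ q) ⟩
    bind ([ _ , _ ] ∘ dist) m' ∎)
    where
      cotuple : [ n₁ , n₂ ] ∘ ((h ×₁ id) +₁ (h ×₁ id)) ≈ [ _ , _ ]
      cotuple = trans≈ ∘[] ([]-cong (trans≈ (pullˡ ι₁-β) (sym≈ p₁)) (trans≈ (pullˡ ι₂-β) (sym≈ p₂)))

  lam-natural : ∀ {h : G' ⇒ G} {k : G × A ⇒ F₀ B} {k' : G' × A ⇒ F₀ B} →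
                k' ≈ k ∘ (h ×₁ id) → η ∘ curry k' ≈ (η ∘ curry k) ∘ h
  lam-natural p = pushʳ (trans≈ (curry-cong p) (sym≈ curry∘))

  proj-weaken : ∀ {Δ Γ' A'} {f : Γ' ⇒ A'} {g : Δ ⇒ A'} {h : Δ ⇒ Γ'} → g ≈ f ∘ h → g ∘ π₁ ≈ (f ∘ π₁) ∘ (h ×₁ id {U})
  proj-weaken p = trans≈ (p ⟩∘⟨refl) (trans≈ assoc (sym≈ (pullʳ π₁-β)))

  proj-ext : ∀ {Γ Δ s} (r : Ren {Sig} Γ Δ) (h : ⟦ Δ ⟧c ⇒ ⟦ Γ ⟧c) →
             (∀ {u} (x : Γ ∋ u) → proj (r x) ≈ proj x ∘ h) →
             ∀ {u} (x : Γ ▸ s ∋ u) → proj (ext {Sig} r x) ≈ proj x ∘ (h ×₁ id)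
  proj-ext r h hr Z = sym≈ (trans≈ π₂-β identityˡ)
  proj-ext r h hr (S x) = proj-weaken (hr x)

  ⟦rename⟧ : ∀ {Γ Δ t} (r : Ren {Sig} Γ Δ) (h : ⟦ Δ ⟧c ⇒ ⟦ Γ ⟧c) →
             (∀ {u} (x : Γ ∋ u) → proj (r x) ≈ proj x ∘ h) →
             (M : Term Sig Γ t) → ⟦ rename r M ⟧tm ≈ ⟦ M ⟧tm ∘ h
  ⟦rename⟧ r h hr (var x) = pushʳ (hr x)
  ⟦rename⟧ r h hr (con c M) = pushʳ (⟦rename⟧ r h hr M)
  ⟦rename⟧ r h hr (eff e M) = pushʳ (pushʳ (⟦rename⟧ r h hr M))
  ⟦rename⟧ r h hr unit = pushʳ (sym≈ (!-unique _))
  ⟦rename⟧ r h hr (pair M N) = pushʳ (pushʳ (pushʳ (⟨⟩-natural (⟦rename⟧ r h hr M) (⟦rename⟧ r h hr N))))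
  ⟦rename⟧ r h hr (fst M) = pushʳ (⟦rename⟧ r h hr M)
  ⟦rename⟧ r h hr (snd M) = pushʳ (⟦rename⟧ r h hr M)
  ⟦rename⟧ r h hr (absurd M) = pushʳ (⟦rename⟧ r h hr M)
  ⟦rename⟧ r h hr (inl M) = pushʳ (⟦rename⟧ r h hr M)
  ⟦rename⟧ r h hr (inr M) = pushʳ (⟦rename⟧ r h hr M)
  ⟦rename⟧ r h hr (case M N₁ N₂) =
    case-natural (⟦rename⟧ (ext {Sig} r) (h ×₁ id) (proj-ext r h hr) N₁) (⟦rename⟧ (ext {Sig} r) (h ×₁ id) (proj-ext r h hr) N₂)
                 (⟦rename⟧ r h hr M)
  ⟦rename⟧ r h hr (lam M) = lam-natural (⟦rename⟧ (ext {Sig} r) (h ×₁ id) (proj-ext r h hr) M)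
  ⟦rename⟧ r h hr (app M N) =
    pushʳ (pushʳ (pushʳ (pushʳ (pushʳ (⟨⟩-natural (⟦rename⟧ r h hr M) (⟦rename⟧ r h hr N))))))

  ⟦exts⟧ : ∀ {Γ Δ s} (σ : Sub {Sig} Γ Δ) (h : ⟦ Δ ⟧c ⇒ ⟦ Γ ⟧c) →
             (∀ {u} (x : Γ ∋ u) → ⟦ σ x ⟧tm ≈ η ∘ proj x ∘ h) →
             ∀ {u} (x : Γ ▸ s ∋ u) → ⟦ exts {Sig} σ x ⟧tm ≈ η ∘ proj x ∘ (h ×₁ id)
  ⟦exts⟧ σ h hσ Z = refl⟩∘⟨ sym≈ (trans≈ π₂-β identityˡ)
  ⟦exts⟧ σ h hσ (S x) = begin
    ⟦ rename S (σ x) ⟧tm          ≈⟨ ⟦rename⟧ S π₁ (λ _ → refl≈) (σ x) ⟩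
    ⟦ σ x ⟧tm ∘ π₁                ≈⟨ trans≈ (hσ x ⟩∘⟨refl) assoc ⟩
    η ∘ (proj x ∘ h) ∘ π₁         ≈⟨ refl⟩∘⟨ proj-weaken refl≈ ⟩
    η ∘ (proj x ∘ π₁) ∘ (h ×₁ id) ∎

  ⟦subst⟧ : ∀ {Γ Δ t} (σ : Sub {Sig} Γ Δ) (h : ⟦ Δ ⟧c ⇒ ⟦ Γ ⟧c) →
            (∀ {u} (x : Γ ∋ u) → ⟦ σ x ⟧tm ≈ η ∘ proj x ∘ h) →
            (M : Term Sig Γ t) → ⟦ subst σ M ⟧tm ≈ ⟦ M ⟧tm ∘ h
  ⟦subst⟧ σ h hσ (var x) = trans≈ (hσ x) sym-assoc
  ⟦subst⟧ σ h hσ (con c M) = pushʳ (⟦subst⟧ σ h hσ M)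
  ⟦subst⟧ σ h hσ (eff e M) = pushʳ (pushʳ (⟦subst⟧ σ h hσ M))
  ⟦subst⟧ σ h hσ unit = pushʳ (sym≈ (!-unique _))
  ⟦subst⟧ σ h hσ (pair M N) = pushʳ (pushʳ (pushʳ (⟨⟩-natural (⟦subst⟧ σ h hσ M) (⟦subst⟧ σ h hσ N))))
  ⟦subst⟧ σ h hσ (fst M) = pushʳ (⟦subst⟧ σ h hσ M)
  ⟦subst⟧ σ h hσ (snd M) = pushʳ (⟦subst⟧ σ h hσ M)
  ⟦subst⟧ σ h hσ (absurd M) = pushʳ (⟦subst⟧ σ h hσ M)
  ⟦subst⟧ σ h hσ (inl M) = pushʳ (⟦subst⟧ σ h hσ M)
  ⟦subst⟧ σ h hσ (inr M) = pushʳ (⟦subst⟧ σ h hσ M)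
  ⟦subst⟧ σ h hσ (case M N₁ N₂) =
    case-natural (⟦subst⟧ (exts σ) (h ×₁ id) (⟦exts⟧ σ h hσ) N₁) (⟦subst⟧ (exts σ) (h ×₁ id) (⟦exts⟧ σ h hσ) N₂)
                 (⟦subst⟧ σ h hσ M)
  ⟦subst⟧ σ h hσ (lam M) = lam-natural (⟦subst⟧ (exts σ) (h ×₁ id) (⟦exts⟧ σ h hσ) M)
  ⟦subst⟧ σ h hσ (app M N) =
    pushʳ (pushʳ (pushʳ (pushʳ (pushʳ (⟨⟩-natural (⟦subst⟧ σ h hσ M) (⟦subst⟧ σ h hσ N))))))

module SPSCorrectness {o ℓ e} (C : BCCC o ℓ e) (T : StrongMonad C) (Y : BCCC.Obj C)
                      (Sig : Signature) (𝒜S : Structure C (SOps C (StrongMonad.ops T) Y) Sig) where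
  open BCCC C
  open BCCCProperties C
  open StrongMonadProperties C T
  open StrongMonad T using (F₀; F₁; η; μ; st; st')
  open SPSSetting C T Y Sig 𝒜S
  open Structure 𝒜S using (ac; ae)
  open Signature Sig using (ar; car; ar-ground; car-ground)
  module TS = Semantics C 𝒜T
  module SS = Semantics C 𝒜S
  open SemanticsProperties C T 𝒜T

  private
    variable
      A A₁ B B₁ D G G' : Obj

  S₁-cong : ∀ {f g : A ⇒ B} → f ≈ g → Sₘ.F₁ f ≈ Sₘ.F₁ g
  S₁-cong p = curry-cong (F-cong (×-cong p refl≈) ⟩∘⟨refl)

  S₁-id : Sₘ.F₁ (id {A}) ≈ id
  S₁-id = trans≈ (curry-cong (elimˡ (trans≈ (F-cong ×-id) F-id))) curry-ev

  S₁-∘ : ∀ {f : A ⇒ B} {g : B ⇒ D} → Sₘ.F₁ g ∘ Sₘ.F₁ f ≈ Sₘ.F₁ (g ∘ f)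
  S₁-∘ {f = f} {g} = begin
    Sₘ.F₁ g ∘ Sₘ.F₁ f                                ≈⟨ curry∘ ⟩
    curry ((F₁ (g ×₁ id) ∘ ev) ∘ (Sₘ.F₁ f ×₁ id))    ≈⟨ curry-cong (pullʳ curry-β′) ⟩
    curry (F₁ (g ×₁ id) ∘ F₁ (f ×₁ id) ∘ ev)         ≈⟨ curry-cong (trans≈ F-fuse (F-cong ×id∘×id ⟩∘⟨refl)) ⟩
    curry (F₁ ((g ∘ f) ×₁ id) ∘ ev)                  ∎

  S₁-inverse : ∀ {f : A ⇒ B} {g : B ⇒ A} → g ∘ f ≈ id → Sₘ.F₁ g ∘ Sₘ.F₁ f ≈ id
  S₁-inverse p = trans≈ S₁-∘ (trans≈ (S₁-cong p) S₁-id)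

  ρ-inverse : ∀ t → (ρ⁻¹ t ∘ ρ t ≈ id) ∧ (ρ t ∘ ρ⁻¹ t ≈ id)
  ρ-inverse (base b) = identityˡ , identityˡ
  ρ-inverse 𝟙 = identityˡ , identityˡ
  ρ-inverse (s ⊗ t) = trans≈ ×∘× (trans≈ (×-cong (proj₁ (ρ-inverse s)) (proj₁ (ρ-inverse t))) ×-id)
                    , trans≈ ×∘× (trans≈ (×-cong (proj₂ (ρ-inverse s)) (proj₂ (ρ-inverse t))) ×-id)
  ρ-inverse 𝟘 = identityˡ , identityˡ
  ρ-inverse (s ⊕ t) = trans≈ +∘+ (trans≈ (+-cong (proj₁ (ρ-inverse s)) (proj₁ (ρ-inverse t))) +-id)
                    , trans≈ +∘+ (trans≈ (+-cong (proj₂ (ρ-inverse s)) (proj₂ (ρ-inverse t))) +-id)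
  ρ-inverse (s ⇛ t) =
      (begin
        (expMap (Sₘ.F₁ (ρ⁻¹ t)) (ρ s) ∘ curryIso⁻¹) ∘ (curryIso ∘ expMap (Sₘ.F₁ (ρ t)) (ρ⁻¹ s))
          ≈⟨ pullʳ (cancelˡ curryIso⁻¹∘curryIso) ⟩
        expMap (Sₘ.F₁ (ρ⁻¹ t)) (ρ s) ∘ expMap (Sₘ.F₁ (ρ t)) (ρ⁻¹ s)
          ≈⟨ expMap-∘ ⟩
        expMap (Sₘ.F₁ (ρ⁻¹ t) ∘ Sₘ.F₁ (ρ t)) (ρ⁻¹ s ∘ ρ s)
          ≈⟨ trans≈ (expMap-cong (S₁-inverse (proj₁ (ρ-inverse t))) (proj₁ (ρ-inverse s))) expMap-id ⟩
        id ∎)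
    , (begin
        (curryIso ∘ expMap (Sₘ.F₁ (ρ t)) (ρ⁻¹ s)) ∘ (expMap (Sₘ.F₁ (ρ⁻¹ t)) (ρ s) ∘ curryIso⁻¹)
          ≈⟨ trans≈ assoc (refl⟩∘⟨ sym-assoc) ⟩
        curryIso ∘ (expMap (Sₘ.F₁ (ρ t)) (ρ⁻¹ s) ∘ expMap (Sₘ.F₁ (ρ⁻¹ t)) (ρ s)) ∘ curryIso⁻¹
          ≈⟨ refl⟩∘⟨ trans≈ expMap-∘ (trans≈ (expMap-cong (S₁-inverse (proj₂ (ρ-inverse t))) (proj₂ (ρ-inverse s))) expMap-id) ⟩∘⟨refl ⟩
        curryIso ∘ id ∘ curryIso⁻¹
          ≈⟨ trans≈ (refl⟩∘⟨ identityˡ) curryIso∘curryIso⁻¹ ⟩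
        id ∎)

  ρ⁻¹∘ρ : ∀ t → ρ⁻¹ t ∘ ρ t ≈ id
  ρ⁻¹∘ρ t = proj₁ (ρ-inverse t)

  ρ∘ρ⁻¹ : ∀ t → ρ t ∘ ρ⁻¹ t ≈ id
  ρ∘ρ⁻¹ t = proj₂ (ρ-inverse t)

  ev∘ρ⇛×id : ∀ s t → ev ∘ (ρ (s ⇛ t) ×₁ id) ≈ F₁ (ρ t ×₁ id) ∘ ev ∘ (ev ×₁ id) ∘ α⁻¹ ∘ (id ×₁ (ρ⁻¹ s ×₁ id))
  ev∘ρ⇛×id s t = begin
    ev ∘ ((curryIso ∘ E) ×₁ id)
      ≈⟨ refl⟩∘⟨ sym≈ ×id∘×id ⟩
    ev ∘ (curryIso ×₁ id) ∘ (E ×₁ id)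
      ≈⟨ trans≈ (pullˡ curry-β′) assoc² ⟩
    ev ∘ (ev ×₁ id) ∘ α⁻¹ ∘ (E ×₁ id)
      ≈⟨ refl⟩∘⟨ refl⟩∘⟨ trans≈ (refl⟩∘⟨ ×-cong refl≈ (sym≈ ×-id)) α⁻¹-natural ⟩
    ev ∘ (ev ×₁ id) ∘ ((E ×₁ id) ×₁ id) ∘ α⁻¹
      ≈⟨ refl⟩∘⟨ pullˡ (trans≈ ×id∘×id (×-cong curry-β′ refl≈)) ⟩
    ev ∘ ((Sₘ.F₁ (ρ t) ∘ ev ∘ (id ×₁ ρ⁻¹ s)) ×₁ id) ∘ α⁻¹
      ≈⟨ refl⟩∘⟨ trans≈ (sym≈ ×id∘×id ⟩∘⟨refl) assoc ⟩
    ev ∘ (Sₘ.F₁ (ρ t) ×₁ id) ∘ ((ev ∘ (id ×₁ ρ⁻¹ s)) ×₁ id) ∘ α⁻¹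
      ≈⟨ trans≈ (pullˡ curry-β′) assoc ⟩
    F₁ (ρ t ×₁ id) ∘ ev ∘ ((ev ∘ (id ×₁ ρ⁻¹ s)) ×₁ id) ∘ α⁻¹
      ≈⟨ refl⟩∘⟨ refl⟩∘⟨ trans≈ (sym≈ ×id∘×id ⟩∘⟨refl) (trans≈ assoc (refl⟩∘⟨ sym≈ α⁻¹-natural)) ⟩
    F₁ (ρ t ×₁ id) ∘ ev ∘ (ev ×₁ id) ∘ α⁻¹ ∘ (id ×₁ (ρ⁻¹ s ×₁ id)) ∎
    where E = expMap (Sₘ.F₁ (ρ t)) (ρ⁻¹ s)

  ρ⁻¹-ground : ∀ {t} (g : Ground t) → ρ⁻¹ t ≈ idCast (groundEq g)
  ρ⁻¹-ground (base b) = refl≈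
  ρ⁻¹-ground 𝟙 = refl≈
  ρ⁻¹-ground (g ⊗ h) = trans≈ (×-cong (ρ⁻¹-ground g) (ρ⁻¹-ground h)) (×-idCast (groundEq g) (groundEq h))
  ρ⁻¹-ground 𝟘 = refl≈
  ρ⁻¹-ground (g ⊕ h) = trans≈ (+-cong (ρ⁻¹-ground g) (ρ⁻¹-ground h)) (+-idCast (groundEq g) (groundEq h))

  ρ-ground : ∀ {t} (g : Ground t) → ρ t ≈ idCast (sym (groundEq g))
  ρ-ground {t} g = begin
    ρ t                                                ≈⟨ elimʳ (idCast∘idCast-sym (groundEq g)) ⟨
    ρ t ∘ idCast (groundEq g) ∘ idCast (sym (groundEq g)) ≈⟨ pullˡ (trans≈ (refl⟩∘⟨ sym≈ (ρ⁻¹-ground g)) (ρ∘ρ⁻¹ t)) ⟩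
    id ∘ idCast (sym (groundEq g))                     ≈⟨ identityˡ ⟩
    idCast (sym (groundEq g))                          ∎

  ρCtx⁻¹-ground : ∀ {Γ} (gΓ : AllGround Γ) → ρCtx⁻¹ Γ ≈ idCast (ctxGroundEq gΓ)
  ρCtx⁻¹-ground ε = refl≈
  ρCtx⁻¹-ground (gΓ ▸ g) = trans≈ (×-cong (ρCtx⁻¹-ground gΓ) (ρ⁻¹-ground g)) (×-idCast (ctxGroundEq gΓ) (groundEq g))

  castT×id-square : (e₁ : A ≡ A₁) (e₂ : B ≡ B₁) (f : A × Y ⇒ F₀ (B × Y)) →
                    cast (cong (_× Y) e₁) (cong (λ X → F₀ (X × Y)) e₂) f ∘ (idCast e₁ ×₁ id) ≈ F₁ (idCast e₂ ×₁ id) ∘ f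
  castT×id-square refl refl f = trans≈ (elimʳ ×-id) (sym≈ (elimˡ (trans≈ (F-cong ×-id) F-id)))

  ⟦_⟧† : ∀ {Γ t} → Term Sig Γ t → ⟦ Γ ⟧Sc × Y ⇒ F₀ (⟦ t ⟧S × Y)
  ⟦ M ⟧† = uncurry SS.⟦ M ⟧tm

  uncurry-Sη∘ : ∀ {a : G ⇒ A} → uncurry (Sₘ.η ∘ a) ≈ η ∘ (a ×₁ id)
  uncurry-Sη∘ = uncurry-curry∘

  uncurry-S₁∘ : ∀ {g : A ⇒ B} {h : G ⇒ Sₘ.F₀ A} → uncurry (Sₘ.F₁ g ∘ h) ≈ F₁ (g ×₁ id) ∘ uncurry h
  uncurry-S₁∘ = trans≈ uncurry-curry∘ assoc

  uncurry-Sμ∘ : ∀ {h : G ⇒ Sₘ.F₀ (Sₘ.F₀ A)} → uncurry (Sₘ.μ ∘ h) ≈ μ ∘ F₁ ev ∘ uncurry h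
  uncurry-Sμ∘ = trans≈ uncurry-curry∘ assoc²

  uncurry-Sst∘ : ∀ {h : G ⇒ A × Sₘ.F₀ B} → uncurry (Sₘ.st ∘ h) ≈ F₁ α⁻¹ ∘ st ∘ (id ×₁ ev) ∘ α ∘ (h ×₁ id)
  uncurry-Sst∘ = trans≈ uncurry-curry∘ assoc³

  uncurry-curry[∘ev]∘ : ∀ {k : A ⇒ B} {h : G ⇒ A ^ Y} → uncurry (curry (k ∘ ev) ∘ h) ≈ k ∘ uncurry h
  uncurry-curry[∘ev]∘ = trans≈ uncurry-curry∘ assoc

  Sst-input : ∀ {g : G ⇒ A} {f : G ⇒ Sₘ.F₀ B} → (id ×₁ ev) ∘ α ∘ (⟨ g , f ⟩ ×₁ id) ≈ ⟨ g ∘ π₁ , uncurry f ⟩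
  Sst-input {g = g} {f} = begin
    (id ×₁ ev) ∘ α ∘ (⟨ g , f ⟩ ×₁ id)
      ≈⟨ refl⟩∘⟨ refl⟩∘⟨ ⟨⟩-cong ⟨⟩∘ identityˡ ⟩
    (id ×₁ ev) ∘ α ∘ ⟨ ⟨ g ∘ π₁ , f ∘ π₁ ⟩ , π₂ ⟩
      ≈⟨ refl⟩∘⟨ α∘⟨⟨⟩⟩ ⟩
    (id ×₁ ev) ∘ ⟨ g ∘ π₁ , ⟨ f ∘ π₁ , π₂ ⟩ ⟩
      ≈⟨ trans≈ id×∘⟨⟩ (⟨⟩-cong refl≈ (refl⟩∘⟨ ⟨⟩-cong refl≈ (sym≈ identityˡ))) ⟩
    ⟨ g ∘ π₁ , uncurry f ⟩ ∎

  ctx-state : ∀ {X Z} → (X × Z) × (A × B) ⇒ X × B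
  ctx-state = ⟨ π₁ ∘ π₁ , π₂ ∘ π₂ ⟩

  ctx-state∘id×⟨×id⟩ : ∀ {X Z A'} {f : A' ⇒ A} → ctx-state ∘ (id {X × Z} ×₁ (f ×₁ id {B})) ≈ ctx-state
  ctx-state∘id×⟨×id⟩ = trans≈ ⟨⟩∘ (⟨⟩-cong (pullʳ (trans≈ π₁-β identityˡ))
                                          (trans≈ (pullʳ π₂-β) (trans≈ sym-assoc (trans≈ (π₂-β ⟩∘⟨refl) (trans≈ assoc identityˡ)))))

  ctx-state∘⟨×id⟩×id : ∀ {X X' Z} {g : X ⇒ X'} →
                       ctx-state ∘ ((g ×₁ id {Z}) ×₁ id {A × B}) ≈ (g ×₁ id) ∘ ctx-state
  ctx-state∘⟨×id⟩×id = begin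
    ctx-state ∘ ((_ ×₁ id) ×₁ id)
      ≈⟨ ⟨⟩∘ ⟩
    ⟨ (π₁ ∘ π₁) ∘ _ , (π₂ ∘ π₂) ∘ _ ⟩
      ≈⟨ ⟨⟩-cong (trans≈ (pullʳ π₁-β) (trans≈ sym-assoc (trans≈ (π₁-β ⟩∘⟨refl) assoc))) (pullʳ (trans≈ π₂-β identityˡ)) ⟩
    ⟨ _ ∘ π₁ ∘ π₁ , π₂ ∘ π₂ ⟩
      ≈⟨ ×id∘⟨⟩ ⟨
    (_ ×₁ id) ∘ ctx-state ∎

  Sst'-input : ∀ {g : G ⇒ Sₘ.F₀ B} →
               (id ×₁ ev) ∘ α ∘ (swap ×₁ id) ∘ α⁻¹ ∘ ((g ∘ π₁ {G} {Y}) ×₁ id {A × Y})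
                 ≈ ⟨ π₁ ∘ π₂ , uncurry g ∘ ctx-state ⟩
  Sst'-input {g = g} = begin
    (id ×₁ ev) ∘ α ∘ (swap ×₁ id) ∘ α⁻¹ ∘ ((g ∘ π₁) ×₁ id)
      ≈⟨ refl⟩∘⟨ refl⟩∘⟨ refl⟩∘⟨ refl⟩∘⟨ ⟨⟩-cong assoc (trans≈ identityˡ ⟨π₁∘,π₂∘⟩) ⟩
    (id ×₁ ev) ∘ α ∘ (swap ×₁ id) ∘ α⁻¹ ∘ ⟨ g ∘ π₁ ∘ π₁ , ⟨ π₁ ∘ π₂ , π₂ ∘ π₂ ⟩ ⟩
      ≈⟨ refl⟩∘⟨ refl⟩∘⟨ refl⟩∘⟨ α⁻¹∘⟨⟨⟩⟩ ⟩
    (id ×₁ ev) ∘ α ∘ (swap ×₁ id) ∘ ⟨ ⟨ g ∘ π₁ ∘ π₁ , π₁ ∘ π₂ ⟩ , π₂ ∘ π₂ ⟩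
      ≈⟨ refl⟩∘⟨ refl⟩∘⟨ trans≈ ×id∘⟨⟩ (⟨⟩-cong swap∘⟨⟩ refl≈) ⟩
    (id ×₁ ev) ∘ α ∘ ⟨ ⟨ π₁ ∘ π₂ , g ∘ π₁ ∘ π₁ ⟩ , π₂ ∘ π₂ ⟩
      ≈⟨ refl⟩∘⟨ α∘⟨⟨⟩⟩ ⟩
    (id ×₁ ev) ∘ ⟨ π₁ ∘ π₂ , ⟨ g ∘ π₁ ∘ π₁ , π₂ ∘ π₂ ⟩ ⟩
      ≈⟨ trans≈ id×∘⟨⟩ (⟨⟩-cong refl≈ (sym≈ uncurry∘⟨⟩)) ⟩
    ⟨ π₁ ∘ π₂ , uncurry g ∘ ctx-state ⟩ ∎

  uncurry-Sst'∘⟨⟩ : ∀ {f : G ⇒ Sₘ.F₀ A} {g : G ⇒ Sₘ.F₀ B} →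
                    uncurry (Sₘ.st' ∘ ⟨ f , g ⟩) ≈ F₁ (swap ×₁ id) ∘ F₁ α⁻¹ ∘ st ∘ ⟨ g ∘ π₁ , uncurry f ⟩
  uncurry-Sst'∘⟨⟩ {f = f} {g} = begin
    uncurry ((Sₘ.F₁ swap ∘ Sₘ.st ∘ swap) ∘ ⟨ f , g ⟩)       ≈⟨ uncurry-cong (trans≈ assoc² (refl⟩∘⟨ refl⟩∘⟨ swap∘⟨⟩)) ⟩
    uncurry (Sₘ.F₁ swap ∘ Sₘ.st ∘ ⟨ g , f ⟩)                ≈⟨ trans≈ uncurry-S₁∘ (refl⟩∘⟨ uncurry-Sst∘) ⟩
    F₁ (swap ×₁ id) ∘ F₁ α⁻¹ ∘ st ∘ (id ×₁ ev) ∘ α ∘ (⟨ g , f ⟩ ×₁ id) ≈⟨ refl⟩∘⟨ refl⟩∘⟨ refl⟩∘⟨ Sst-input ⟩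
    F₁ (swap ×₁ id) ∘ F₁ α⁻¹ ∘ st ∘ ⟨ g ∘ π₁ , uncurry f ⟩  ∎

  ⟦eff⟧† : ∀ {Γ} (e : Signature.E Sig) (M : Term Sig Γ _) → ⟦ eff e M ⟧† ≈ μ ∘ F₁ (uncurry (ae e)) ∘ ⟦ M ⟧†
  ⟦eff⟧† e M = trans≈ uncurry-Sμ∘ (refl⟩∘⟨ trans≈ (refl⟩∘⟨ uncurry-S₁∘) F-fuse)

  ⟦pair⟧† : ∀ {Γ s t} (M : Term Sig Γ s) (N : Term Sig Γ t) →
            ⟦ pair M N ⟧† ≈ bind (F₁ α⁻¹ ∘ st ∘ ⟨ π₁ ∘ π₂ , ⟦ N ⟧† ∘ ctx-state ⟩) ⟦ M ⟧†
  ⟦pair⟧† M N = begin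
    uncurry (Sₘ.μ ∘ Sₘ.F₁ Sₘ.st ∘ Sₘ.st' ∘ ⟨ SS.⟦ M ⟧tm , g ⟩)
      ≈⟨ trans≈ uncurry-Sμ∘ (refl⟩∘⟨ refl⟩∘⟨ trans≈ uncurry-S₁∘ (refl⟩∘⟨ uncurry-Sst'∘⟨⟩)) ⟩
    μ ∘ F₁ ev ∘ F₁ (Sₘ.st ×₁ id) ∘ F₁ (swap ×₁ id) ∘ F₁ α⁻¹ ∘ st ∘ ⟨ g ∘ π₁ , ⟦ M ⟧† ⟩
      ≈⟨ trans≈ (refl⟩∘⟨ F-fuse₄) μ∘F₁∘st∘⟨⟩ ⟩
    bind ((ev ∘ (Sₘ.st ×₁ id) ∘ (swap ×₁ id) ∘ α⁻¹) ∘ ((g ∘ π₁) ×₁ id)) ⟦ M ⟧†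
      ≈⟨ bind-cong body refl≈ ⟩
    bind (F₁ α⁻¹ ∘ st ∘ ⟨ π₁ ∘ π₂ , ⟦ N ⟧† ∘ ctx-state ⟩) ⟦ M ⟧† ∎
    where
      g = SS.⟦ N ⟧tm
      body : (ev ∘ (Sₘ.st ×₁ id) ∘ (swap ×₁ id) ∘ α⁻¹) ∘ ((g ∘ π₁) ×₁ id)
               ≈ F₁ α⁻¹ ∘ st ∘ ⟨ π₁ ∘ π₂ , ⟦ N ⟧† ∘ ctx-state ⟩
      body = begin
        (ev ∘ (Sₘ.st ×₁ id) ∘ (swap ×₁ id) ∘ α⁻¹) ∘ ((g ∘ π₁) ×₁ id)
          ≈⟨ trans≈ assoc³ (pullˡ curry-β′) ⟩
        (F₁ α⁻¹ ∘ st ∘ (id ×₁ ev) ∘ α) ∘ (swap ×₁ id) ∘ α⁻¹ ∘ ((g ∘ π₁) ×₁ id)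
          ≈⟨ trans≈ assoc³ (refl⟩∘⟨ refl⟩∘⟨ Sst'-input) ⟩
        F₁ α⁻¹ ∘ st ∘ ⟨ π₁ ∘ π₂ , ⟦ N ⟧† ∘ ctx-state ⟩ ∎

  ⟦app⟧† : ∀ {Γ s t} (M : Term Sig Γ (s ⇛ t)) (N : Term Sig Γ s) →
           ⟦ app M N ⟧† ≈ bind (bind ((ev ∘ (ev ×₁ id) ∘ α⁻¹) ∘ ((π₁ ∘ π₂) ×₁ id)) (⟦ N ⟧† ∘ ctx-state)) ⟦ M ⟧†
  ⟦app⟧† M N = begin
    uncurry (Sₘ.μ ∘ Sₘ.F₁ Sₘ.μ ∘ Sₘ.F₁ (Sₘ.F₁ ev) ∘ Sₘ.F₁ Sₘ.st ∘ Sₘ.st' ∘ ⟨ SS.⟦ M ⟧tm , g ⟩)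
      ≈⟨ trans≈ uncurry-Sμ∘ (refl⟩∘⟨ refl⟩∘⟨ trans≈ uncurry-S₁∘ (refl⟩∘⟨ trans≈ uncurry-S₁∘
           (refl⟩∘⟨ trans≈ uncurry-S₁∘ (refl⟩∘⟨ uncurry-Sst'∘⟨⟩)))) ⟩
    μ ∘ F₁ ev ∘ F₁ (Sₘ.μ ×₁ id) ∘ F₁ (Sₘ.F₁ ev ×₁ id) ∘ F₁ (Sₘ.st ×₁ id) ∘ F₁ (swap ×₁ id)
      ∘ F₁ α⁻¹ ∘ st ∘ ⟨ g ∘ π₁ , ⟦ M ⟧† ⟩
      ≈⟨ trans≈ (refl⟩∘⟨ F-fuse₆) μ∘F₁∘st∘⟨⟩ ⟩
    bind ((ev ∘ (Sₘ.μ ×₁ id) ∘ (Sₘ.F₁ ev ×₁ id) ∘ (Sₘ.st ×₁ id) ∘ (swap ×₁ id) ∘ α⁻¹) ∘ ((g ∘ π₁) ×₁ id)) ⟦ M ⟧†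
      ≈⟨ bind-cong body refl≈ ⟩
    bind (bind ((ev ∘ (ev ×₁ id) ∘ α⁻¹) ∘ ((π₁ ∘ π₂) ×₁ id)) (⟦ N ⟧† ∘ ctx-state)) ⟦ M ⟧† ∎
    where
      g = SS.⟦ N ⟧tm
      body : (ev ∘ (Sₘ.μ ×₁ id) ∘ (Sₘ.F₁ ev ×₁ id) ∘ (Sₘ.st ×₁ id) ∘ (swap ×₁ id) ∘ α⁻¹) ∘ ((g ∘ π₁) ×₁ id)
               ≈ bind ((ev ∘ (ev ×₁ id) ∘ α⁻¹) ∘ ((π₁ ∘ π₂) ×₁ id)) (⟦ N ⟧† ∘ ctx-state)
      body = begin
        (ev ∘ (Sₘ.μ ×₁ id) ∘ (Sₘ.F₁ ev ×₁ id) ∘ (Sₘ.st ×₁ id) ∘ (swap ×₁ id) ∘ α⁻¹) ∘ ((g ∘ π₁) ×₁ id)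
          ≈⟨ trans≈ assoc⁵ (trans≈ (pullˡ curry-β′) assoc²) ⟩
        μ ∘ F₁ ev ∘ ev ∘ (Sₘ.F₁ ev ×₁ id) ∘ (Sₘ.st ×₁ id) ∘ (swap ×₁ id) ∘ α⁻¹ ∘ ((g ∘ π₁) ×₁ id)
          ≈⟨ refl⟩∘⟨ refl⟩∘⟨ trans≈ (pullˡ curry-β′) assoc ⟩
        μ ∘ F₁ ev ∘ F₁ (ev ×₁ id) ∘ ev ∘ (Sₘ.st ×₁ id) ∘ (swap ×₁ id) ∘ α⁻¹ ∘ ((g ∘ π₁) ×₁ id)
          ≈⟨ refl⟩∘⟨ refl⟩∘⟨ refl⟩∘⟨ trans≈ (pullˡ curry-β′) (trans≈ assoc³ (refl⟩∘⟨ refl⟩∘⟨ Sst'-input)) ⟩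
        μ ∘ F₁ ev ∘ F₁ (ev ×₁ id) ∘ F₁ α⁻¹ ∘ st ∘ ⟨ π₁ ∘ π₂ , ⟦ N ⟧† ∘ ctx-state ⟩
          ≈⟨ trans≈ (refl⟩∘⟨ F-fuse₃) μ∘F₁∘st∘⟨⟩ ⟩
        bind ((ev ∘ (ev ×₁ id) ∘ α⁻¹) ∘ ((π₁ ∘ π₂) ×₁ id)) (⟦ N ⟧† ∘ ctx-state) ∎

  ⟦case⟧† : ∀ {Γ s t u} (M : Term Sig Γ (s ⊕ t)) (N₁ : Term Sig (Γ ▸ s) u) (N₂ : Term Sig (Γ ▸ t) u) →
            ⟦ case M N₁ N₂ ⟧† ≈ bind ((ev ∘ (([ SS.⟦ N₁ ⟧tm , SS.⟦ N₂ ⟧tm ] ∘ dist) ×₁ id) ∘ α⁻¹) ∘ (π₁ ×₁ id)) ⟦ M ⟧†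
  ⟦case⟧† M N₁ N₂ = begin
    uncurry (Sₘ.μ ∘ Sₘ.F₁ k ∘ Sₘ.st ∘ ⟨ id , SS.⟦ M ⟧tm ⟩)
      ≈⟨ trans≈ uncurry-Sμ∘ (refl⟩∘⟨ refl⟩∘⟨ trans≈ uncurry-S₁∘ (refl⟩∘⟨ uncurry-Sst∘)) ⟩
    μ ∘ F₁ ev ∘ F₁ (k ×₁ id) ∘ F₁ α⁻¹ ∘ st ∘ (id ×₁ ev) ∘ α ∘ (⟨ id , SS.⟦ M ⟧tm ⟩ ×₁ id)
      ≈⟨ refl⟩∘⟨ refl⟩∘⟨ refl⟩∘⟨ refl⟩∘⟨ refl⟩∘⟨ trans≈ Sst-input (⟨⟩-cong identityˡ refl≈) ⟩
    μ ∘ F₁ ev ∘ F₁ (k ×₁ id) ∘ F₁ α⁻¹ ∘ st ∘ ⟨ π₁ , ⟦ M ⟧† ⟩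
      ≈⟨ trans≈ (refl⟩∘⟨ F-fuse₃) μ∘F₁∘st∘⟨⟩ ⟩
    bind ((ev ∘ (k ×₁ id) ∘ α⁻¹) ∘ (π₁ ×₁ id)) ⟦ M ⟧† ∎
    where
      k = [ SS.⟦ N₁ ⟧tm , SS.⟦ N₂ ⟧tm ] ∘ dist

  Sig' : Signature
  Sig' = SPSSig Sig

  -- the semantic counterpart of the substitution [π₁z/x, π₂z/y] performed by rebind
  rebinding : ∀ {X Z} → (X × Y) × (Z × Y) ⇒ (X × Z) × Y
  rebinding = ⟨ ⟨ π₁ ∘ π₁ , π₁ ∘ π₂ ⟩ , π₂ ∘ π₂ ⟩

  ⟦rebind⟧ : ∀ {Γ s t} (K : Term Sig' (ctx° Γ ▸ s ° ▸ bY) t) → TS.⟦ rebind K ⟧tm ≈ TS.⟦ K ⟧tm ∘ rebinding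
  ⟦rebind⟧ = ⟦subst⟧ _ rebinding λ
    { Z → trans≈ F₁∘η∘ (refl⟩∘⟨ sym≈ π₂-β)
    ; (S Z) → trans≈ F₁∘η∘ (refl⟩∘⟨ sym≈ (trans≈ (pullʳ π₁-β) π₂-β))
    ; (S (S x)) → refl⟩∘⟨ sym≈ (trans≈ (pullʳ π₁-β) (trans≈ (pullʳ π₁-β) sym-assoc)) }

  ⟦reY⟧ : ∀ {Γ u t} (K : Term Sig' (SPSctx Γ) t) →
          TS.⟦ reY {Γ = Γ} {u = u} K ⟧tm ≈ TS.⟦ K ⟧tm ∘ ⟨ π₁ ∘ π₁ ∘ π₁ , π₂ ⟩
  ⟦reY⟧ = ⟦rename⟧ _ ⟨ π₁ ∘ π₁ ∘ π₁ , π₂ ⟩ λ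
    { Z → sym≈ π₂-β
    ; (S x) → trans≈ assoc (trans≈ assoc (sym≈ (pullʳ π₁-β))) }

  ⟦app-lam⟧ : ∀ {Δ u v} (K : Term Sig' (Δ ▸ u) v) (N : Term Sig' Δ u) →
              TS.⟦ app (lam K) N ⟧tm ≈ bind TS.⟦ K ⟧tm TS.⟦ N ⟧tm
  ⟦app-lam⟧ K N = trans≈ application-value (bind-cong curry-β′ refl≈)

  -- SPS of fst, snd, absurd, inl and inr applies a pure map w to the value and passes the state on
  ⟦app-lam-pure⟧ : ∀ {Δ a b} {w : ⟦ a ⟧T ⇒ ⟦ b ⟧T} (K : Term Sig' (Δ ▸ (a ⊗ bY)) b) (N : Term Sig' Δ (a ⊗ bY)) →
                   TS.⟦ K ⟧tm ≈ F₁ w ∘ TS.⟦ fst (z {Δ = Δ} {t = a ⊗ bY}) ⟧tm →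
                   TS.⟦ app (lam (pair K (snd z))) N ⟧tm ≈ F₁ (w ×₁ id) ∘ TS.⟦ N ⟧tm
  ⟦app-lam-pure⟧ {w = w} K N p = begin
    TS.⟦ app (lam (pair K (snd z))) N ⟧tm
      ≈⟨ ⟦app-lam⟧ (pair K (snd z)) N ⟩
    bind (μ ∘ F₁ st ∘ st' ∘ ⟨ TS.⟦ K ⟧tm , F₁ π₂ ∘ η ∘ π₂ ⟩) n
      ≈⟨ bind-cong (trans≈ (refl⟩∘⟨ refl⟩∘⟨ refl⟩∘⟨ ⟨⟩-cong value F₁∘η∘) pairing-values) refl≈ ⟩
    bind (η ∘ ⟨ w ∘ π₁ ∘ π₂ , π₂ ∘ π₂ ⟩) n
      ≈⟨ bind-cong (refl⟩∘⟨ trans≈ (⟨⟩-cong sym-assoc (sym≈ (trans≈ assoc identityˡ))) (sym≈ ⟨⟩∘)) refl≈ ⟩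
    bind (η ∘ (w ×₁ id) ∘ π₂) n
      ≈⟨ bind-return ⟩
    F₁ (w ×₁ id) ∘ n ∎
    where
      n = TS.⟦ N ⟧tm
      value : TS.⟦ K ⟧tm ≈ η ∘ w ∘ π₁ ∘ π₂
      value = trans≈ p (trans≈ (refl⟩∘⟨ F₁∘η∘) F₁∘η∘)

  ρCtx⁻¹×Y : ∀ Γ → ⟦ ctx° Γ ⟧Tc × Y ⇒ ⟦ Γ ⟧Sc × Y
  ρCtx⁻¹×Y Γ = ρCtx⁻¹ Γ ×₁ id

  ρ×Y : ∀ t → ⟦ t ⟧S × Y ⇒ ⟦ t ° ⟧T × Y
  ρ×Y t = ρ t ×₁ id

  Simulated : ∀ {Γ t} → Term Sig Γ t → Set e
  Simulated {Γ} {t} M = TS.⟦ SPS M ⟧tm ≈ F₁ (ρ×Y t) ∘ ⟦ M ⟧† ∘ ρCtx⁻¹×Y Γ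

  value-simulation : ∀ {Γ t} {v : ⟦ Γ ⟧Sc ⇒ ⟦ t ⟧S} {f : ⟦ ctx° Γ ⟧Tc × Y ⇒ ⟦ t ° ⟧T} →
                     f ≈ (ρ t ∘ v ∘ ρCtx⁻¹ Γ) ∘ π₁ →
                     η ∘ ⟨ f , π₂ ⟩ ≈ F₁ (ρ×Y t) ∘ uncurry (Sₘ.η ∘ v) ∘ ρCtx⁻¹×Y Γ
  value-simulation {Γ} {t} {v} {f} p = begin
    η ∘ ⟨ f , π₂ ⟩                                    ≈⟨ refl⟩∘⟨ ⟨⟩-cong p (sym≈ identityˡ) ⟩
    η ∘ ((ρ t ∘ v ∘ ρCtx⁻¹ Γ) ×₁ id)                  ≈⟨ refl⟩∘⟨ trans≈ (refl⟩∘⟨ ×id∘×id) ×id∘×id ⟨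
    η ∘ ρ×Y t ∘ (v ×₁ id) ∘ ρCtx⁻¹×Y Γ                ≈⟨ F₁∘η∘ ⟨
    F₁ (ρ×Y t) ∘ η ∘ (v ×₁ id) ∘ ρCtx⁻¹×Y Γ           ≈⟨ refl⟩∘⟨ trans≈ (uncurry-Sη∘ ⟩∘⟨refl) assoc ⟨
    F₁ (ρ×Y t) ∘ uncurry (Sₘ.η ∘ v) ∘ ρCtx⁻¹×Y Γ      ∎

  proj-ρ : ∀ {Γ t} (x : Γ ∋ t) → ρ t ∘ SS.proj x ∘ ρCtx⁻¹ Γ ≈ TS.proj (var° x)
  proj-ρ {Γ ▸ t} Z = trans≈ (refl⟩∘⟨ π₂-β) (cancelˡ (ρ∘ρ⁻¹ t))
  proj-ρ {Γ ▸ s} {t} (S x) = begin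
    ρ t ∘ (SS.proj x ∘ π₁) ∘ (ρCtx⁻¹ Γ ×₁ ρ⁻¹ s)   ≈⟨ refl⟩∘⟨ pullʳ π₁-β ⟩
    ρ t ∘ SS.proj x ∘ ρCtx⁻¹ Γ ∘ π₁                ≈⟨ trans≈ (refl⟩∘⟨ sym-assoc) sym-assoc ⟩
    (ρ t ∘ SS.proj x ∘ ρCtx⁻¹ Γ) ∘ π₁              ≈⟨ proj-ρ x ⟩∘⟨refl ⟩
    TS.proj (var° x) ∘ π₁                          ∎

  simulated-var : ∀ {Γ t} (x : Γ ∋ t) → Simulated (var x)
  simulated-var {Γ} {t} x = trans≈ pairing-values (value-simulation {Γ} {t} (sym≈ (proj-ρ x) ⟩∘⟨refl))

  simulated-unit : ∀ {Γ} → Simulated {Γ} unit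
  simulated-unit {Γ} = trans≈ pairing-values (value-simulation {Γ} {𝟙} (sym≈ (!-unique _)))

  simulated-con : ∀ {Γ} (c : Signature.K Sig) (M : Term Sig Γ _) → Simulated M → Simulated (con c M)
  simulated-con c M ih = F₁-simulation square ih uncurry-S₁∘
    where
      a = ar (inj₁ c)
      b = car (inj₁ c)
      eᵃ = groundEq (ar-ground (inj₁ c))
      eᵇ = groundEq (car-ground (inj₁ c))
      square : Structure.ac 𝒜T c ∘ ρ×Y a ≈ ρ×Y b ∘ (ac c ×₁ id)
      square = begin
        Structure.ac 𝒜T c ∘ ρ×Y a                  ≈⟨ refl⟩∘⟨ ×-cong (ρ-ground (ar-ground (inj₁ c))) refl≈ ⟩
        Structure.ac 𝒜T c ∘ (idCast (sym eᵃ) ×₁ id) ≈⟨ cast×id-square (sym eᵃ) (sym eᵇ) (ac c ×₁ id) ⟩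
        (idCast (sym eᵇ) ×₁ id) ∘ (ac c ×₁ id)     ≈⟨ ×-cong (ρ-ground (car-ground (inj₁ c))) refl≈ ⟩∘⟨refl ⟨
        ρ×Y b ∘ (ac c ×₁ id)                       ∎

  simulated-eff : ∀ {Γ} (e : Signature.E Sig) (M : Term Sig Γ _) → Simulated M → Simulated (eff e M)
  simulated-eff e M ih = μF₁-simulation square ih (⟦eff⟧† e M)
    where
      a = ar (inj₂ e)
      b = car (inj₂ e)
      eᵃ = groundEq (ar-ground (inj₂ e))
      eᵇ = groundEq (car-ground (inj₂ e))
      square : Structure.ae 𝒜T e ∘ ρ×Y a ≈ F₁ (ρ×Y b) ∘ uncurry (ae e)
      square = begin
        Structure.ae 𝒜T e ∘ ρ×Y a                  ≈⟨ refl⟩∘⟨ ×-cong (ρ-ground (ar-ground (inj₂ e))) refl≈ ⟩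
        Structure.ae 𝒜T e ∘ (idCast (sym eᵃ) ×₁ id) ≈⟨ castT×id-square (sym eᵃ) (sym eᵇ) (uncurry (ae e)) ⟩
        F₁ (idCast (sym eᵇ) ×₁ id) ∘ uncurry (ae e) ≈⟨ F-cong (×-cong (ρ-ground (car-ground (inj₂ e))) refl≈) ⟩∘⟨refl ⟨
        F₁ (ρ×Y b) ∘ uncurry (ae e)                ∎

  ⟦SPS-in-state⟧ : ∀ {Γ a t} (N : Term Sig Γ t) →
                   TS.⟦ app (lam (reY {Γ = Γ} {u = a ⊗ bY} (SPS N))) (snd z) ⟧tm ≈ TS.⟦ SPS N ⟧tm ∘ ctx-state
  ⟦SPS-in-state⟧ N = begin
    _                                                              ≈⟨ ⟦app-lam⟧ (reY (SPS N)) (snd z) ⟩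
    bind TS.⟦ reY (SPS N) ⟧tm (F₁ π₂ ∘ η ∘ π₂)
      ≈⟨ bind-cong (⟦reY⟧ (SPS N)) F₁∘η∘ ⟩
    bind (TS.⟦ SPS N ⟧tm ∘ ⟨ π₁ ∘ π₁ ∘ π₁ , π₂ ⟩) (η ∘ π₂ ∘ π₂)
      ≈⟨ trans≈ bind-η assoc ⟩
    TS.⟦ SPS N ⟧tm ∘ ⟨ π₁ ∘ π₁ ∘ π₁ , π₂ ⟩ ∘ ⟨ id , π₂ ∘ π₂ ⟩
      ≈⟨ refl⟩∘⟨ trans≈ ⟨⟩∘ (⟨⟩-cong (trans≈ assoc (refl⟩∘⟨ trans≈ (pullʳ π₁-β) identityʳ)) π₂-β) ⟩
    TS.⟦ SPS N ⟧tm ∘ ctx-state ∎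

  reassociate : ∀ {Γ s t} → Term Sig' (SPSctx Γ ▸ (s ° ⊗ (t ° ⊗ bY))) ((s ° ⊗ t °) ⊗ bY)
  reassociate = pair (pair (fst z) (fst (snd z))) (snd (snd z))

  ⟦reassociate⟧ : ∀ {Γ s t} → TS.⟦ reassociate {Γ} {s} {t} ⟧tm ≈ η ∘ α⁻¹ ∘ π₂
  ⟦reassociate⟧ = begin
    μ ∘ F₁ st ∘ st' ∘ ⟨ μ ∘ F₁ st ∘ st' ∘ ⟨ F₁ π₁ ∘ η ∘ π₂ , F₁ π₁ ∘ F₁ π₂ ∘ η ∘ π₂ ⟩
                      , F₁ π₂ ∘ F₁ π₂ ∘ η ∘ π₂ ⟩
      ≈⟨ refl⟩∘⟨ refl⟩∘⟨ refl⟩∘⟨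
           ⟨⟩-cong (trans≈ (refl⟩∘⟨ refl⟩∘⟨ refl⟩∘⟨ ⟨⟩-cong F₁∘η∘ (trans≈ (refl⟩∘⟨ F₁∘η∘) F₁∘η∘)) pairing-values)
                   (trans≈ (refl⟩∘⟨ F₁∘η∘) F₁∘η∘) ⟩
    μ ∘ F₁ st ∘ st' ∘ ⟨ η ∘ ⟨ π₁ ∘ π₂ , π₁ ∘ π₂ ∘ π₂ ⟩ , η ∘ π₂ ∘ π₂ ∘ π₂ ⟩
      ≈⟨ pairing-values ⟩
    η ∘ ⟨ ⟨ π₁ ∘ π₂ , π₁ ∘ π₂ ∘ π₂ ⟩ , π₂ ∘ π₂ ∘ π₂ ⟩
      ≈⟨ refl⟩∘⟨ trans≈ ⟨⟩∘ (⟨⟩-cong (trans≈ ⟨⟩∘ (⟨⟩-cong refl≈ assoc)) assoc) ⟨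
    η ∘ α⁻¹ ∘ π₂ ∎

  simulated-pair : ∀ {Γ s t} (M : Term Sig Γ s) (N : Term Sig Γ t) →
                   Simulated M → Simulated N → Simulated (pair M N)
  simulated-pair {Γ} {s} {t} M N ihM ihN = begin
    TS.⟦ SPS (pair M N) ⟧tm
      ≈⟨ ⟦app-lam⟧ (reassociate {Γ} {s} {t}) (app (lam pair-with-N) (SPS M)) ⟩
    bind TS.⟦ reassociate {Γ} {s} {t} ⟧tm TS.⟦ app (lam pair-with-N) (SPS M) ⟧tm
      ≈⟨ bind-cong (⟦reassociate⟧ {Γ} {s} {t}) (⟦app-lam⟧ pair-with-N (SPS M)) ⟩
    bind (η ∘ α⁻¹ ∘ π₂) (bind TS.⟦ pair-with-N ⟧tm TS.⟦ SPS M ⟧tm)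
      ≈⟨ trans≈ bind-return F₁∘bind ⟩
    bind (F₁ α⁻¹ ∘ TS.⟦ pair-with-N ⟧tm) TS.⟦ SPS M ⟧tm
      ≈⟨ bind-cong (refl⟩∘⟨ pair-with-N-value) ihM ⟩
    bind (F₁ α⁻¹ ∘ st ∘ ⟨ π₁ ∘ π₂ , TS.⟦ SPS N ⟧tm ∘ ctx-state ⟩) (F₁ (ρ×Y s) ∘ ⟦ M ⟧† ∘ ρCtx⁻¹×Y Γ)
      ≈⟨ bind-F₁ ⟩
    bind ((F₁ α⁻¹ ∘ st ∘ ⟨ π₁ ∘ π₂ , TS.⟦ SPS N ⟧tm ∘ ctx-state ⟩) ∘ (id ×₁ ρ×Y s)) (⟦ M ⟧† ∘ ρCtx⁻¹×Y Γ)
      ≈⟨ bind-cong body refl≈ ⟩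
    bind (F₁ (ρ×Y (s ⊗ t)) ∘ continuation ∘ (ρCtx⁻¹×Y Γ ×₁ id)) (⟦ M ⟧† ∘ ρCtx⁻¹×Y Γ)
      ≈⟨ trans≈ (refl⟩∘⟨ bind-∘) F₁∘bind ⟨
    F₁ (ρ×Y (s ⊗ t)) ∘ bind continuation ⟦ M ⟧† ∘ ρCtx⁻¹×Y Γ
      ≈⟨ refl⟩∘⟨ (⟦pair⟧† M N ⟩∘⟨refl) ⟨
    F₁ (ρ×Y (s ⊗ t)) ∘ ⟦ pair M N ⟧† ∘ ρCtx⁻¹×Y Γ ∎
    where
      pair-with-N : Term Sig' (SPSctx Γ ▸ (s ° ⊗ bY)) (s ° ⊗ (t ° ⊗ bY))
      pair-with-N = pair (fst z) (app (lam (reY (SPS N))) (snd z))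
      continuation = F₁ α⁻¹ ∘ st ∘ ⟨ π₁ ∘ π₂ , ⟦ N ⟧† ∘ ctx-state ⟩
      pair-with-N-value : TS.⟦ pair-with-N ⟧tm ≈ st ∘ ⟨ π₁ ∘ π₂ , TS.⟦ SPS N ⟧tm ∘ ctx-state ⟩
      pair-with-N-value = trans≈ (refl⟩∘⟨ refl⟩∘⟨ refl⟩∘⟨ ⟨⟩-cong F₁∘η∘ (⟦SPS-in-state⟧ N)) pairing-valueˡ
      body : (F₁ α⁻¹ ∘ st ∘ ⟨ π₁ ∘ π₂ , TS.⟦ SPS N ⟧tm ∘ ctx-state ⟩) ∘ (id ×₁ ρ×Y s)
               ≈ F₁ (ρ×Y (s ⊗ t)) ∘ continuation ∘ (ρCtx⁻¹×Y Γ ×₁ id)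
      body = begin
        (F₁ α⁻¹ ∘ st ∘ ⟨ π₁ ∘ π₂ , TS.⟦ SPS N ⟧tm ∘ ctx-state ⟩) ∘ (id ×₁ ρ×Y s)
          ≈⟨ trans≈ assoc² (refl⟩∘⟨ refl⟩∘⟨ trans≈ ⟨⟩∘
               (⟨⟩-cong π₁∘π₂-natural (trans≈ assoc (trans≈ (refl⟩∘⟨ ctx-state∘id×⟨×id⟩) (ihN ⟩∘⟨refl))))) ⟩
        F₁ α⁻¹ ∘ st ∘ ⟨ ρ s ∘ π₁ ∘ π₂ , (F₁ (ρ×Y t) ∘ ⟦ N ⟧† ∘ ρCtx⁻¹×Y Γ) ∘ ctx-state ⟩
          ≈⟨ refl⟩∘⟨ refl⟩∘⟨ trans≈ ×∘⟨⟩ (⟨⟩-cong refl≈ (trans≈ (refl⟩∘⟨ sym-assoc) sym-assoc)) ⟨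
        F₁ α⁻¹ ∘ st ∘ (ρ s ×₁ F₁ (ρ×Y t)) ∘ ⟨ π₁ ∘ π₂ , ⟦ N ⟧† ∘ ρCtx⁻¹×Y Γ ∘ ctx-state ⟩
          ≈⟨ refl⟩∘⟨ pullˡ st-nat ⟩
        F₁ α⁻¹ ∘ (F₁ (ρ s ×₁ ρ×Y t) ∘ st) ∘ ⟨ π₁ ∘ π₂ , ⟦ N ⟧† ∘ ρCtx⁻¹×Y Γ ∘ ctx-state ⟩
          ≈⟨ trans≈ (refl⟩∘⟨ assoc) F-fuse ⟩
        F₁ (α⁻¹ ∘ (ρ s ×₁ ρ×Y t)) ∘ st ∘ ⟨ π₁ ∘ π₂ , ⟦ N ⟧† ∘ ρCtx⁻¹×Y Γ ∘ ctx-state ⟩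
          ≈⟨ trans≈ (F-cong α⁻¹-natural ⟩∘⟨refl) (sym≈ F-fuse) ⟩
        F₁ (ρ×Y (s ⊗ t)) ∘ F₁ α⁻¹ ∘ st ∘ ⟨ π₁ ∘ π₂ , ⟦ N ⟧† ∘ ρCtx⁻¹×Y Γ ∘ ctx-state ⟩
          ≈⟨ refl⟩∘⟨ trans≈ assoc² (refl⟩∘⟨ refl⟩∘⟨ trans≈ ⟨⟩∘
               (⟨⟩-cong π₁∘π₂∘×id (trans≈ assoc (refl⟩∘⟨ ctx-state∘⟨×id⟩×id)))) ⟨
        F₁ (ρ×Y (s ⊗ t)) ∘ continuation ∘ (ρCtx⁻¹×Y Γ ×₁ id) ∎

  simulated-app : ∀ {Γ s t} (M : Term Sig Γ (s ⇛ t)) (N : Term Sig Γ s) →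
                  Simulated M → Simulated N → Simulated (app M N)
  simulated-app {Γ} {s} {t} M N ihM ihN = begin
    TS.⟦ SPS (app M N) ⟧tm                                               ≈⟨ ⟦app-lam⟧ call-with-N (SPS M) ⟩
    bind TS.⟦ call-with-N ⟧tm TS.⟦ SPS M ⟧tm                               ≈⟨ bind-cong call-with-N-value ihM ⟩
    bind (bind callᵀ (n̂ ∘ ctx-state)) (F₁ (ρ×Y (s ⇛ t)) ∘ ⟦ M ⟧† ∘ ρCtx⁻¹×Y Γ) ≈⟨ bind-F₁ ⟩
    bind (bind callᵀ (n̂ ∘ ctx-state) ∘ (id ×₁ ρ×Y (s ⇛ t))) (⟦ M ⟧† ∘ ρCtx⁻¹×Y Γ)
      ≈⟨ bind-cong inner refl≈ ⟩
    bind (bind (F₁ (ρ×Y t) ∘ callˢ ∘ ((ρCtx⁻¹×Y Γ ×₁ id) ×₁ id)) ((⟦ N ⟧† ∘ ctx-state) ∘ (ρCtx⁻¹×Y Γ ×₁ id)))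
         (⟦ M ⟧† ∘ ρCtx⁻¹×Y Γ)
      ≈⟨ trans≈ (refl⟩∘⟨ bind-∘) (trans≈ F₁∘bind (bind-cong (trans≈ (refl⟩∘⟨ bind-∘) F₁∘bind) refl≈)) ⟨
    F₁ (ρ×Y t) ∘ bind (bind callˢ (⟦ N ⟧† ∘ ctx-state)) ⟦ M ⟧† ∘ ρCtx⁻¹×Y Γ ≈⟨ refl⟩∘⟨ (⟦app⟧† M N ⟩∘⟨refl) ⟨
    F₁ (ρ×Y t) ∘ ⟦ app M N ⟧† ∘ ρCtx⁻¹×Y Γ                               ∎
    where
      call-with-N : Term Sig' (SPSctx Γ ▸ (((s ° ⊗ bY) ⇛ (t ° ⊗ bY)) ⊗ bY)) (t ° ⊗ bY)
      call-with-N = app (fst z) (app (lam (reY (SPS N))) (snd z))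
      n̂ = TS.⟦ SPS N ⟧tm
      callᵀ = ev ∘ ((π₁ ∘ π₂) ×₁ id)
      callˢ = (ev ∘ (ev ×₁ id) ∘ α⁻¹) ∘ ((π₁ ∘ π₂) ×₁ id)
      call-with-N-value : TS.⟦ call-with-N ⟧tm ≈ bind callᵀ (n̂ ∘ ctx-state)
      call-with-N-value =
        trans≈ (refl⟩∘⟨ refl⟩∘⟨ refl⟩∘⟨ refl⟩∘⟨ refl⟩∘⟨ ⟨⟩-cong F₁∘η∘ (⟦SPS-in-state⟧ N)) application-value
      body : (callᵀ ∘ ((id ×₁ ρ×Y (s ⇛ t)) ×₁ id)) ∘ (id ×₁ ρ×Y s) ≈ F₁ (ρ×Y t) ∘ callˢ ∘ ((ρCtx⁻¹×Y Γ ×₁ id) ×₁ id)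
      body = begin
        (callᵀ ∘ ((id ×₁ ρ×Y (s ⇛ t)) ×₁ id)) ∘ (id ×₁ ρ×Y s)
          ≈⟨ trans≈ (assoc ⟩∘⟨refl) (trans≈ assoc (refl⟩∘⟨ (trans≈ ×id∘×id (×-cong π₁∘π₂-natural refl≈) ⟩∘⟨refl))) ⟩
        ev ∘ ((ρ (s ⇛ t) ∘ π₁ ∘ π₂) ×₁ id) ∘ (id ×₁ ρ×Y s)
          ≈⟨ refl⟩∘⟨ trans≈ ×∘× (trans≈ (×-cong identityʳ (trans≈ identityˡ (sym≈ identityˡ))) (sym≈ ×∘×)) ⟩
        ev ∘ (ρ (s ⇛ t) ×₁ id) ∘ ((π₁ ∘ π₂) ×₁ ρ×Y s)
          ≈⟨ trans≈ (pullˡ (ev∘ρ⇛×id s t)) assoc⁴ ⟩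
        F₁ (ρ×Y t) ∘ ev ∘ (ev ×₁ id) ∘ α⁻¹ ∘ (id ×₁ (ρ⁻¹ s ×₁ id)) ∘ ((π₁ ∘ π₂) ×₁ ρ×Y s)
          ≈⟨ refl⟩∘⟨ refl⟩∘⟨ refl⟩∘⟨ refl⟩∘⟨
               trans≈ ×∘× (×-cong identityˡ (trans≈ ×id∘×id (trans≈ (×-cong (ρ⁻¹∘ρ s) refl≈) ×-id))) ⟩
        F₁ (ρ×Y t) ∘ ev ∘ (ev ×₁ id) ∘ α⁻¹ ∘ ((π₁ ∘ π₂) ×₁ id)
          ≈⟨ refl⟩∘⟨ trans≈ assoc
               (trans≈ assoc² (refl⟩∘⟨ refl⟩∘⟨ refl⟩∘⟨ trans≈ ×id∘×id (×-cong π₁∘π₂∘×id refl≈))) ⟨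
        F₁ (ρ×Y t) ∘ callˢ ∘ ((ρCtx⁻¹×Y Γ ×₁ id) ×₁ id) ∎
      inner : bind callᵀ (n̂ ∘ ctx-state) ∘ (id ×₁ ρ×Y (s ⇛ t))
                ≈ bind (F₁ (ρ×Y t) ∘ callˢ ∘ ((ρCtx⁻¹×Y Γ ×₁ id) ×₁ id)) ((⟦ N ⟧† ∘ ctx-state) ∘ (ρCtx⁻¹×Y Γ ×₁ id))
      inner = begin
        bind callᵀ (n̂ ∘ ctx-state) ∘ (id ×₁ ρ×Y (s ⇛ t))
          ≈⟨ bind-∘ ⟩
        bind (callᵀ ∘ ((id ×₁ ρ×Y (s ⇛ t)) ×₁ id)) ((n̂ ∘ ctx-state) ∘ (id ×₁ ρ×Y (s ⇛ t)))
          ≈⟨ bind-cong refl≈ (trans≈ (pullʳ ctx-state∘id×⟨×id⟩) (trans≈ (ihN ⟩∘⟨refl) assoc²)) ⟩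
        bind (callᵀ ∘ ((id ×₁ ρ×Y (s ⇛ t)) ×₁ id)) (F₁ (ρ×Y s) ∘ ⟦ N ⟧† ∘ ρCtx⁻¹×Y Γ ∘ ctx-state)
          ≈⟨ bind-F₁ ⟩
        bind ((callᵀ ∘ ((id ×₁ ρ×Y (s ⇛ t)) ×₁ id)) ∘ (id ×₁ ρ×Y s)) (⟦ N ⟧† ∘ ρCtx⁻¹×Y Γ ∘ ctx-state)
          ≈⟨ bind-cong body (sym≈ (pullʳ ctx-state∘⟨×id⟩×id)) ⟩
        bind (F₁ (ρ×Y t) ∘ callˢ ∘ ((ρCtx⁻¹×Y Γ ×₁ id) ×₁ id)) ((⟦ N ⟧† ∘ ctx-state) ∘ (ρCtx⁻¹×Y Γ ×₁ id)) ∎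

  ev∘ρ⇛∘curry : ∀ {s t} {k : G × ⟦ s ⟧S ⇒ Sₘ.F₀ ⟦ t ⟧S} {g : G' ⇒ G} →
                ev ∘ ((ρ (s ⇛ t) ∘ curry k ∘ g) ×₁ id) ≈ F₁ (ρ×Y t) ∘ uncurry k ∘ ((g ×₁ ρ⁻¹ s) ×₁ id) ∘ α⁻¹
  ev∘ρ⇛∘curry {s = s} {t} {k} {g} = begin
    ev ∘ ((ρ (s ⇛ t) ∘ curry k ∘ g) ×₁ id)
      ≈⟨ refl⟩∘⟨ sym≈ ×id∘×id ⟩
    ev ∘ (ρ (s ⇛ t) ×₁ id) ∘ ((curry k ∘ g) ×₁ id)
      ≈⟨ trans≈ (pullˡ (ev∘ρ⇛×id s t)) assoc⁴ ⟩
    F₁ (ρ×Y t) ∘ ev ∘ (ev ×₁ id) ∘ α⁻¹ ∘ (id ×₁ (ρ⁻¹ s ×₁ id)) ∘ ((curry k ∘ g) ×₁ id)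
      ≈⟨ refl⟩∘⟨ refl⟩∘⟨ refl⟩∘⟨ trans≈ (refl⟩∘⟨ trans≈ ×∘× (×-cong identityˡ identityʳ)) α⁻¹-natural ⟩
    F₁ (ρ×Y t) ∘ ev ∘ (ev ×₁ id) ∘ (((curry k ∘ g) ×₁ ρ⁻¹ s) ×₁ id) ∘ α⁻¹
      ≈⟨ refl⟩∘⟨ refl⟩∘⟨ pullˡ ×id∘×id ⟩
    F₁ (ρ×Y t) ∘ ev ∘ ((ev ∘ ((curry k ∘ g) ×₁ ρ⁻¹ s)) ×₁ id) ∘ α⁻¹
      ≈⟨ refl⟩∘⟨ refl⟩∘⟨ ×-cong evaluate refl≈ ⟩∘⟨refl ⟩
    F₁ (ρ×Y t) ∘ ev ∘ ((k ∘ (g ×₁ ρ⁻¹ s)) ×₁ id) ∘ α⁻¹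
      ≈⟨ refl⟩∘⟨ trans≈ (refl⟩∘⟨ (sym≈ ×id∘×id ⟩∘⟨refl)) (trans≈ (refl⟩∘⟨ assoc) sym-assoc) ⟩
    F₁ (ρ×Y t) ∘ uncurry k ∘ ((g ×₁ ρ⁻¹ s) ×₁ id) ∘ α⁻¹ ∎
    where
      evaluate : ev ∘ ((curry k ∘ g) ×₁ ρ⁻¹ s) ≈ k ∘ (g ×₁ ρ⁻¹ s)
      evaluate = trans≈ (refl⟩∘⟨ trans≈ (×-cong refl≈ (sym≈ identityˡ)) (sym≈ ×∘×)) (pullˡ curry-β′)

  α⁻¹-rebinding : ∀ {X X' Z Z'} {g : X ⇒ X'} {r : Z ⇒ Z'} →
                  (((g ∘ π₁ {X} {Y}) ×₁ r) ×₁ id {Y}) ∘ α⁻¹ ≈ ((g ×₁ r) ×₁ id) ∘ rebinding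
  α⁻¹-rebinding {g = g} {r} = begin
    (((g ∘ π₁) ×₁ r) ×₁ id) ∘ α⁻¹
      ≈⟨ trans≈ ×∘⟨⟩ (⟨⟩-cong ×∘⟨⟩ identityˡ) ⟩
    ⟨ ⟨ (g ∘ π₁) ∘ π₁ , r ∘ π₁ ∘ π₂ ⟩ , π₂ ∘ π₂ ⟩
      ≈⟨ trans≈ ×∘⟨⟩ (⟨⟩-cong (trans≈ ×∘⟨⟩ (⟨⟩-cong sym-assoc refl≈)) identityˡ) ⟨
    ((g ×₁ r) ×₁ id) ∘ rebinding ∎

  curry-rebind : ∀ {Γ s t} (M : Term Sig (Γ ▸ s) t) → Simulated M →
                 curry TS.⟦ rebind (SPS M) ⟧tm ≈ (ρ (s ⇛ t) ∘ curry SS.⟦ M ⟧tm ∘ ρCtx⁻¹ Γ) ∘ π₁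
  curry-rebind {Γ} {s} {t} M ih = sym≈ (curry-unique′ (begin
    ev ∘ (((ρ (s ⇛ t) ∘ curry SS.⟦ M ⟧tm ∘ ρCtx⁻¹ Γ) ∘ π₁) ×₁ id)  ≈⟨ refl⟩∘⟨ ×-cong assoc² refl≈ ⟩
    ev ∘ ((ρ (s ⇛ t) ∘ curry SS.⟦ M ⟧tm ∘ ρCtx⁻¹ Γ ∘ π₁) ×₁ id)    ≈⟨ ev∘ρ⇛∘curry {s = s} {t} ⟩
    F₁ (ρ×Y t) ∘ ⟦ M ⟧† ∘ (((ρCtx⁻¹ Γ ∘ π₁) ×₁ ρ⁻¹ s) ×₁ id) ∘ α⁻¹  ≈⟨ refl⟩∘⟨ refl⟩∘⟨ α⁻¹-rebinding ⟩
    F₁ (ρ×Y t) ∘ ⟦ M ⟧† ∘ ρCtx⁻¹×Y (Γ ▸ s) ∘ rebinding              ≈⟨ trans≈ (ih ⟩∘⟨refl) assoc² ⟨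
    TS.⟦ SPS M ⟧tm ∘ rebinding                                      ≈⟨ ⟦rebind⟧ (SPS M) ⟨
    TS.⟦ rebind (SPS M) ⟧tm                                         ∎))

  simulated-lam : ∀ {Γ s t} (M : Term Sig (Γ ▸ s) t) → Simulated M → Simulated (lam M)
  simulated-lam {Γ} {s} {t} M ih = trans≈ pairing-values (value-simulation {Γ} {s ⇛ t} (curry-rebind M ih))

  scrutinee-distʳ : ∀ {X A B} →
                    [ ι₁ ∘ ⟨ π₂ , π₂ ∘ π₂ ∘ π₁ ⟩ , ι₂ ∘ ⟨ π₂ , π₂ ∘ π₂ ∘ π₁ ⟩ ] ∘ dist ∘ ⟨ id , π₁ ∘ π₂ ⟩
                      ≈ distʳ {A} {B} {Y} ∘ π₂ {X}
  scrutinee-distʳ = case-ext (restricted dist-ι₁ ι₁-β distʳ-ι₁) (restricted dist-ι₂ ι₂-β distʳ-ι₂)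
    where
      c : ∀ {W Z D} → (W × (Z × Y)) × D ⇒ D × Y
      c = ⟨ π₂ , π₂ ∘ π₂ ∘ π₁ ⟩
      retag : ∀ {X A B D} {ι : D ⇒ A + B} → c ∘ ⟨ id {X} ×₁ (ι ×₁ id {Y}) , π₁ ∘ π₂ ⟩ ≈ π₂
      retag = begin
        c ∘ ⟨ id ×₁ (_ ×₁ id) , π₁ ∘ π₂ ⟩
          ≈⟨ trans≈ ⟨⟩∘ (⟨⟩-cong π₂-β (trans≈ assoc (refl⟩∘⟨ pullʳ π₁-β))) ⟩
        ⟨ π₁ ∘ π₂ , π₂ ∘ π₂ ∘ (id ×₁ (_ ×₁ id)) ⟩
          ≈⟨ ⟨⟩-cong refl≈ (trans≈ (refl⟩∘⟨ π₂-β) (trans≈ (pullˡ π₂-β) (trans≈ assoc identityˡ))) ⟩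
        ⟨ π₁ ∘ π₂ , π₂ ∘ π₂ ⟩
          ≈⟨ ⟨π₁∘,π₂∘⟩ ⟨
        π₂ ∎
      restricted : ∀ {X A B D} {ι : D ⇒ A + B} {jL : (X × ((A + B) × Y)) × D ⇒ _} {jR : D × Y ⇒ (A × Y) + (B × Y)} →
        dist ∘ (id ×₁ ι) ≈ jL → [ ι₁ ∘ c , ι₂ ∘ c ] ∘ jL ≈ jR ∘ c → distʳ ∘ (ι ×₁ id) ≈ jR →
        ([ ι₁ ∘ c , ι₂ ∘ c ] ∘ dist ∘ ⟨ id , π₁ ∘ π₂ ⟩) ∘ (id ×₁ (ι ×₁ id)) ≈ (distʳ ∘ π₂) ∘ (id ×₁ (ι ×₁ id))
      restricted {ι = ι} {jL} {jR} dist-ι ι-β distʳ-ι = begin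
        ([ ι₁ ∘ c , ι₂ ∘ c ] ∘ dist ∘ ⟨ id , π₁ ∘ π₂ ⟩) ∘ (id ×₁ (ι ×₁ id))
          ≈⟨ trans≈ assoc² (refl⟩∘⟨ refl⟩∘⟨ trans≈ ⟨⟩∘ (trans≈ (⟨⟩-cong identityˡ π₁∘π₂-natural) (sym≈ id×∘⟨⟩))) ⟩
        [ ι₁ ∘ c , ι₂ ∘ c ] ∘ dist ∘ (id ×₁ ι) ∘ ⟨ id ×₁ (ι ×₁ id) , π₁ ∘ π₂ ⟩
          ≈⟨ refl⟩∘⟨ pullˡ dist-ι ⟩
        [ ι₁ ∘ c , ι₂ ∘ c ] ∘ jL ∘ ⟨ id ×₁ (ι ×₁ id) , π₁ ∘ π₂ ⟩
          ≈⟨ trans≈ (pullˡ ι-β) (trans≈ assoc (refl⟩∘⟨ retag)) ⟩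
        jR ∘ π₂
          ≈⟨ trans≈ (pullʳ π₂-β) (trans≈ sym-assoc (distʳ-ι ⟩∘⟨refl)) ⟨
        (distʳ ∘ π₂) ∘ (id ×₁ (ι ×₁ id)) ∎

  scrutinee : ∀ {Γ s t} → Term Sig' (SPSctx Γ ▸ ((s ° ⊕ t °) ⊗ bY)) ((s ° ⊗ bY) ⊕ (t ° ⊗ bY))
  scrutinee = case (fst z) (inl (pair (var Z) (snd (var (S Z))))) (inr (pair (var Z) (snd (var (S Z)))))

  ⟦scrutinee⟧ : ∀ {Γ s t} → TS.⟦ scrutinee {Γ} {s} {t} ⟧tm ≈ η ∘ distʳ ∘ π₂
  ⟦scrutinee⟧ = begin
    bind ([ _ , _ ] ∘ dist) (F₁ π₁ ∘ η ∘ π₂)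
      ≈⟨ trans≈ (bind-cong refl≈ F₁∘η∘) bind-η ⟩
    ([ F₁ ι₁ ∘ μ ∘ F₁ st ∘ st' ∘ ⟨ η ∘ π₂ , F₁ π₂ ∘ η ∘ π₂ ∘ π₁ ⟩
     , F₁ ι₂ ∘ μ ∘ F₁ st ∘ st' ∘ ⟨ η ∘ π₂ , F₁ π₂ ∘ η ∘ π₂ ∘ π₁ ⟩ ] ∘ dist) ∘ ⟨ id , π₁ ∘ π₂ ⟩
      ≈⟨ ([]-cong tagged tagged ⟩∘⟨refl) ⟩∘⟨refl ⟩
    ([ η ∘ ι₁ ∘ ⟨ π₂ , π₂ ∘ π₂ ∘ π₁ ⟩ , η ∘ ι₂ ∘ ⟨ π₂ , π₂ ∘ π₂ ∘ π₁ ⟩ ] ∘ dist) ∘ ⟨ id , π₁ ∘ π₂ ⟩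
      ≈⟨ (∘[] ⟩∘⟨refl) ⟩∘⟨refl ⟨
    ((η ∘ [ ι₁ ∘ ⟨ π₂ , π₂ ∘ π₂ ∘ π₁ ⟩ , ι₂ ∘ ⟨ π₂ , π₂ ∘ π₂ ∘ π₁ ⟩ ]) ∘ dist) ∘ ⟨ id , π₁ ∘ π₂ ⟩
      ≈⟨ trans≈ assoc (trans≈ assoc (refl⟩∘⟨ scrutinee-distʳ)) ⟩
    η ∘ distʳ ∘ π₂ ∎
    where
      tagged : ∀ {W Z A B} {ι : A × Y ⇒ B} →
               F₁ ι ∘ μ ∘ F₁ st ∘ st' ∘ ⟨ η ∘ π₂ , F₁ π₂ ∘ η ∘ π₂ ∘ π₁ {W × (Z × Y)} {A} ⟩
                 ≈ η ∘ ι ∘ ⟨ π₂ , π₂ ∘ π₂ ∘ π₁ ⟩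
      tagged = trans≈ (refl⟩∘⟨ trans≈ (refl⟩∘⟨ refl⟩∘⟨ refl⟩∘⟨ ⟨⟩-cong refl≈ F₁∘η∘) pairing-values) F₁∘η∘

  case-branch : ∀ {Γ a u X} (N : Term Sig (Γ ▸ a) u) {ι : ⟦ a ⟧S ⇒ X} {k : ⟦ Γ ⟧Sc × X ⇒ Sₘ.F₀ ⟦ u ⟧S} →
                k ∘ (id ×₁ ι) ≈ SS.⟦ N ⟧tm → Simulated N →
                TS.⟦ rebind (SPS N) ⟧tm ∘ (id ×₁ ρ×Y a)
                  ≈ (F₁ (ρ×Y u) ∘ ((ev ∘ (k ×₁ id) ∘ α⁻¹) ∘ (π₁ ×₁ id)) ∘ (ρCtx⁻¹×Y Γ ×₁ id)) ∘ (id ×₁ (ι ×₁ id))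
  case-branch {Γ} {a} {u} N {ι} {k} branch ih = begin
    TS.⟦ rebind (SPS N) ⟧tm ∘ (id ×₁ ρ×Y a)
      ≈⟨ trans≈ (trans≈ (⟦rebind⟧ (SPS N)) (ih ⟩∘⟨refl) ⟩∘⟨refl) (trans≈ (assoc² ⟩∘⟨refl) assoc³) ⟩
    F₁ (ρ×Y u) ∘ ⟦ N ⟧† ∘ ρCtx⁻¹×Y (Γ ▸ a) ∘ rebinding ∘ (id ×₁ ρ×Y a)
      ≈⟨ refl⟩∘⟨ refl⟩∘⟨ trans≈ sym-assoc (trans≈ (sym≈ α⁻¹-rebinding ⟩∘⟨refl) (pullʳ α⁻¹-natural)) ⟩
    F₁ (ρ×Y u) ∘ ⟦ N ⟧† ∘ (((ρCtx⁻¹ Γ ∘ π₁) ×₁ ρ⁻¹ a) ×₁ id) ∘ ((id ×₁ ρ a) ×₁ id) ∘ α⁻¹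
      ≈⟨ refl⟩∘⟨ refl⟩∘⟨ pullˡ (trans≈ ×id∘×id (×-cong (trans≈ ×∘× (×-cong identityʳ (ρ⁻¹∘ρ a))) refl≈)) ⟩
    F₁ (ρ×Y u) ∘ ⟦ N ⟧† ∘ (((ρCtx⁻¹ Γ ∘ π₁) ×₁ id) ×₁ id) ∘ α⁻¹
      ≈⟨ refl⟩∘⟨ trans≈ (refl⟩∘⟨ pullˡ (trans≈ ×id∘×id (×-cong branch refl≈))) sym-assoc ⟨
    F₁ (ρ×Y u) ∘ ev ∘ (k ×₁ id) ∘ ((id ×₁ ι) ×₁ id) ∘ (((ρCtx⁻¹ Γ ∘ π₁) ×₁ id) ×₁ id) ∘ α⁻¹
      ≈⟨ refl⟩∘⟨ refl⟩∘⟨ refl⟩∘⟨ reorder ⟨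
    F₁ (ρ×Y u) ∘ ev ∘ (k ×₁ id) ∘ α⁻¹ ∘ (π₁ ×₁ id) ∘ (ρCtx⁻¹×Y Γ ×₁ id) ∘ (id ×₁ (ι ×₁ id))
      ≈⟨ trans≈ assoc (refl⟩∘⟨ trans≈ assoc (trans≈ assoc assoc²)) ⟨
    (F₁ (ρ×Y u) ∘ ((ev ∘ (k ×₁ id) ∘ α⁻¹) ∘ (π₁ ×₁ id)) ∘ (ρCtx⁻¹×Y Γ ×₁ id)) ∘ (id ×₁ (ι ×₁ id)) ∎
    where
      reorder : α⁻¹ ∘ (π₁ ×₁ id) ∘ (ρCtx⁻¹×Y Γ ×₁ id) ∘ (id ×₁ (ι ×₁ id))
                  ≈ ((id ×₁ ι) ×₁ id) ∘ (((ρCtx⁻¹ Γ ∘ π₁) ×₁ id) ×₁ id) ∘ α⁻¹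
      reorder = begin
        α⁻¹ ∘ (π₁ ×₁ id) ∘ (ρCtx⁻¹×Y Γ ×₁ id) ∘ (id ×₁ (ι ×₁ id))
          ≈⟨ refl⟩∘⟨ refl⟩∘⟨ trans≈ ×∘× (×-cong identityʳ identityˡ) ⟩
        α⁻¹ ∘ (π₁ ×₁ id) ∘ (ρCtx⁻¹×Y Γ ×₁ (ι ×₁ id))
          ≈⟨ refl⟩∘⟨ trans≈ ×∘× (×-cong π₁-β identityˡ) ⟩
        α⁻¹ ∘ ((ρCtx⁻¹ Γ ∘ π₁) ×₁ (ι ×₁ id))
          ≈⟨ α⁻¹-natural ⟩
        (((ρCtx⁻¹ Γ ∘ π₁) ×₁ ι) ×₁ id) ∘ α⁻¹
          ≈⟨ pullˡ (trans≈ ×id∘×id (×-cong (trans≈ ×∘× (×-cong identityˡ identityʳ)) refl≈)) ⟨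
        ((id ×₁ ι) ×₁ id) ∘ (((ρCtx⁻¹ Γ ∘ π₁) ×₁ id) ×₁ id) ∘ α⁻¹ ∎

  simulated-case : ∀ {Γ s t u} (M : Term Sig Γ (s ⊕ t)) (N₁ : Term Sig (Γ ▸ s) u) (N₂ : Term Sig (Γ ▸ t) u) →
                   Simulated M → Simulated N₁ → Simulated N₂ → Simulated (case M N₁ N₂)
  simulated-case {Γ} {s} {t} {u} M N₁ N₂ ihM ih₁ ih₂ = begin
    bind branches TS.⟦ app (lam (scrutinee {Γ} {s} {t})) (SPS M) ⟧tm
      ≈⟨ bind-cong refl≈ (trans≈ (⟦app-lam⟧ (scrutinee {Γ} {s} {t}) (SPS M)) (trans≈ (bind-cong (⟦scrutinee⟧ {Γ} {s} {t}) refl≈) bind-return)) ⟩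
    bind branches (F₁ distʳ ∘ TS.⟦ SPS M ⟧tm)
      ≈⟨ trans≈ bind-F₁ (bind-cong refl≈ ihM) ⟩
    bind (branches ∘ (id ×₁ distʳ)) (F₁ (ρ×Y (s ⊕ t)) ∘ ⟦ M ⟧† ∘ ρCtx⁻¹×Y Γ)
      ≈⟨ trans≈ bind-F₁ (bind-cong (trans≈ assoc (case-ext (branch N₁ ι₁-β distʳ-ι₁ []∘dist-ι₁ []∘dist-ι₁ ih₁)
                                                             (branch N₂ ι₂-β distʳ-ι₂ []∘dist-ι₂ []∘dist-ι₂ ih₂))) refl≈) ⟩
    bind (F₁ (ρ×Y u) ∘ continuation ∘ (ρCtx⁻¹×Y Γ ×₁ id)) (⟦ M ⟧† ∘ ρCtx⁻¹×Y Γ)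
      ≈⟨ trans≈ (refl⟩∘⟨ bind-∘) F₁∘bind ⟨
    F₁ (ρ×Y u) ∘ bind continuation ⟦ M ⟧† ∘ ρCtx⁻¹×Y Γ
      ≈⟨ refl⟩∘⟨ (⟦case⟧† M N₁ N₂ ⟩∘⟨refl) ⟨
    F₁ (ρ×Y u) ∘ ⟦ case M N₁ N₂ ⟧† ∘ ρCtx⁻¹×Y Γ ∎
    where
      branches = [ TS.⟦ rebind (SPS N₁) ⟧tm , TS.⟦ rebind (SPS N₂) ⟧tm ] ∘ dist
      k = [ SS.⟦ N₁ ⟧tm , SS.⟦ N₂ ⟧tm ] ∘ dist
      continuation = (ev ∘ (k ×₁ id) ∘ α⁻¹) ∘ (π₁ ×₁ id)
      branch : ∀ {a} (N : Term Sig (Γ ▸ a) u) {ιS : ⟦ a ⟧S ⇒ ⟦ s ⊕ t ⟧S} {ιT : ⟦ a ° ⟧T ⇒ ⟦ (s ⊕ t) ° ⟧T}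
                 {ι× : ⟦ a ° ⟧T × Y ⇒ (⟦ s ° ⟧T × Y) + (⟦ t ° ⟧T × Y)} →
               ρ (s ⊕ t) ∘ ιS ≈ ιT ∘ ρ a → distʳ ∘ (ιT ×₁ id) ≈ ι× → branches ∘ (id ×₁ ι×) ≈ TS.⟦ rebind (SPS N) ⟧tm →
               k ∘ (id ×₁ ιS) ≈ SS.⟦ N ⟧tm → Simulated N →
               (branches ∘ (id ×₁ distʳ) ∘ (id ×₁ ρ×Y (s ⊕ t))) ∘ (id ×₁ (ιS ×₁ id))
                 ≈ (F₁ (ρ×Y u) ∘ continuation ∘ (ρCtx⁻¹×Y Γ ×₁ id)) ∘ (id ×₁ (ιS ×₁ id))
      branch {a} N {ιS} {ιT} {ι×} ρ-ι distʳ-ι branches-ι k-ι ih = begin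
        (branches ∘ (id ×₁ distʳ) ∘ (id ×₁ ρ×Y (s ⊕ t))) ∘ (id ×₁ (ιS ×₁ id))
          ≈⟨ trans≈ assoc² (refl⟩∘⟨ id×∘id×∘id×) ⟩
        branches ∘ (id ×₁ (distʳ ∘ ρ×Y (s ⊕ t) ∘ (ιS ×₁ id)))
          ≈⟨ refl⟩∘⟨ ×-cong refl≈ (trans≈ (refl⟩∘⟨ ×id-square ρ-ι) (pullˡ distʳ-ι)) ⟩
        branches ∘ (id ×₁ (ι× ∘ ρ×Y a))
          ≈⟨ refl⟩∘⟨ trans≈ (×-cong (sym≈ identityˡ) refl≈) (sym≈ ×∘×) ⟩
        branches ∘ (id ×₁ ι×) ∘ (id ×₁ ρ×Y a)
          ≈⟨ pullˡ branches-ι ⟩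
        TS.⟦ rebind (SPS N) ⟧tm ∘ (id ×₁ ρ×Y a)
          ≈⟨ case-branch N k-ι ih ⟩
        (F₁ (ρ×Y u) ∘ continuation ∘ (ρCtx⁻¹×Y Γ ×₁ id)) ∘ (id ×₁ (ιS ×₁ id)) ∎

  simulated : ∀ {Γ t} (M : Term Sig Γ t) → Simulated M
  simulated (var x) = simulated-var x
  simulated {Γ} unit = simulated-unit {Γ}
  simulated (con c M) = simulated-con c M (simulated M)
  simulated (eff e M) = simulated-eff e M (simulated M)
  simulated (pair M N) = simulated-pair M N (simulated M) (simulated N)
  simulated (fst {s} M) =
    trans≈ (⟦app-lam-pure⟧ {b = s °} (fst (fst z)) (SPS M) refl≈) (F₁-simulation (×id-square π₁-β) (simulated M) uncurry-S₁∘)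
  simulated (snd {t = t} M) =
    trans≈ (⟦app-lam-pure⟧ {b = t °} (snd (fst z)) (SPS M) refl≈) (F₁-simulation (×id-square π₂-β) (simulated M) uncurry-S₁∘)
  simulated (absurd {t} M) =
    trans≈ (⟦app-lam-pure⟧ {b = t °} (absurd (fst z)) (SPS M) refl≈)
           (F₁-simulation (×id-square (trans≈ (¡-unique _) (sym≈ (¡-unique _)))) (simulated M) uncurry-S₁∘)
  simulated (inl {s} {t} M) =
    trans≈ (⟦app-lam-pure⟧ {b = (s ⊕ t) °} (inl (fst z)) (SPS M) refl≈) (F₁-simulation (×id-square (sym≈ ι₁-β)) (simulated M) uncurry-S₁∘)
  simulated (inr {s} {t} M) =
    trans≈ (⟦app-lam-pure⟧ {b = (s ⊕ t) °} (inr (fst z)) (SPS M) refl≈) (F₁-simulation (×id-square (sym≈ ι₂-β)) (simulated M) uncurry-S₁∘)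
  simulated (case M N₁ N₂) = simulated-case M N₁ N₂ (simulated M) (simulated N₁) (simulated N₂)
  simulated (lam M) = simulated-lam M (simulated M)
  simulated (app M N) = simulated-app M N (simulated M) (simulated N)

  uncurry-wpS : ∀ {Ω Γ t} (τ : F₀ Ω ⇒ Ω) (M : Term Sig Γ t) (Q : ⟦ t ⟧S ⇒ Ω ^ Y) →
                uncurry (wpS (τS τ) M Q) ≈ τ ∘ F₁ (uncurry Q) ∘ ⟦ M ⟧†
  uncurry-wpS τ M Q = begin
    uncurry ((curry (τ ∘ ev) ∘ curry (F₁ ev ∘ ev)) ∘ Sₘ.F₁ Q ∘ SS.⟦ M ⟧tm)
      ≈⟨ trans≈ (uncurry-cong assoc) (trans≈ uncurry-curry[∘ev]∘ (refl⟩∘⟨ trans≈ uncurry-curry[∘ev]∘ (refl⟩∘⟨ uncurry-S₁∘))) ⟩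
    τ ∘ F₁ ev ∘ F₁ (Q ×₁ id) ∘ ⟦ M ⟧†
      ≈⟨ refl⟩∘⟨ F-fuse ⟩
    τ ∘ F₁ (uncurry Q) ∘ ⟦ M ⟧† ∎

  wp-simulation : ∀ {Ω Γ t} (τ : F₀ Ω ⇒ Ω) (M : Term Sig Γ t) (Q : ⟦ t ⟧S ⇒ Ω ^ Y) →
                  uncurry (wpS (τS τ) M Q ∘ ρCtx⁻¹ Γ) ≈ wpT τ (SPS M) (uncurry (Q ∘ ρ⁻¹ t))
  wp-simulation {Γ = Γ} {t} τ M Q = begin
    uncurry (wpS (τS τ) M Q ∘ ρCtx⁻¹ Γ)
      ≈⟨ trans≈ uncurry∘ (uncurry-wpS τ M Q ⟩∘⟨refl) ⟩
    (τ ∘ F₁ (uncurry Q) ∘ ⟦ M ⟧†) ∘ ρCtx⁻¹×Y Γ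
      ≈⟨ trans≈ assoc² (refl⟩∘⟨ F-cong (sym≈ postcondition) ⟩∘⟨refl) ⟩
    τ ∘ F₁ (uncurry (Q ∘ ρ⁻¹ t) ∘ ρ×Y t) ∘ ⟦ M ⟧† ∘ ρCtx⁻¹×Y Γ ≈⟨ refl⟩∘⟨ trans≈ (refl⟩∘⟨ simulated M) F-fuse ⟨
    τ ∘ F₁ (uncurry (Q ∘ ρ⁻¹ t)) ∘ TS.⟦ SPS M ⟧tm              ∎
    where
      postcondition : uncurry (Q ∘ ρ⁻¹ t) ∘ ρ×Y t ≈ uncurry Q
      postcondition = trans≈ (uncurry∘ ⟩∘⟨refl) (trans≈ assoc (elimʳ (trans≈ ×id∘×id (trans≈ (×-cong (ρ⁻¹∘ρ t) refl≈) ×-id))))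

  wp-simulation-ground : ∀ {Ω Γ t} (τ : F₀ Ω ⇒ Ω) (M : Term Sig Γ t) (Q : ⟦ t ⟧S ⇒ Ω ^ Y) →
                         (gΓ : AllGround Γ) (gt : Ground t) →
                         uncurry (wpS (τS τ) M Q)
                           ≈ cast (cong (_× Y) (ctxGroundEq gΓ)) refl
                               (wpT τ (SPS M) (cast (cong (_× Y) (sym (groundEq gt))) refl (uncurry Q)))
  wp-simulation-ground {Γ = Γ} {t} τ M Q gΓ gt = cast-transpose (ctxGroundEq gΓ) (begin
    wpT τ (SPS M) (cast (cong (_× Y) (sym (groundEq gt))) refl (uncurry Q))
      ≈⟨ refl⟩∘⟨ F-cong postcondition ⟩∘⟨refl ⟨
    wpT τ (SPS M) (uncurry (Q ∘ ρ⁻¹ t))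
      ≈⟨ wp-simulation τ M Q ⟨
    uncurry (wpS (τS τ) M Q ∘ ρCtx⁻¹ Γ)
      ≈⟨ trans≈ uncurry∘ (refl⟩∘⟨ ×-cong (ρCtx⁻¹-ground gΓ) refl≈) ⟩
    uncurry (wpS (τS τ) M Q) ∘ (idCast (ctxGroundEq gΓ) ×₁ id) ∎)
    where
      postcondition : uncurry (Q ∘ ρ⁻¹ t) ≈ cast (cong (_× Y) (sym (groundEq gt))) refl (uncurry Q)
      postcondition = trans≈ uncurry∘ (trans≈ (refl⟩∘⟨ ×-cong (ρ⁻¹-ground gt) refl≈) (∘idCast×id (groundEq gt) (uncurry Q)))

theorem5p5 : ∀ {o ℓ e} (C : BCCC o ℓ e) (T : StrongMonad C) (Y : BCCC.Obj C)
    (Sig : Signature) (𝒜S : Structure C (SOps C (StrongMonad.ops T) Y) Sig)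
    (Ω : BCCC.Obj C) (alg : EMAlgebra C T Ω) →
    let open BCCC C
        open SPSSetting C T Y Sig 𝒜S
        τT = EMAlgebra.τ alg
    in ∀ {Γ t} (M : Term Sig Γ t) (Q : ⟦ t ⟧S ⇒ Ω ^ Y) →
       (uncurry (wpS (τS τT) M Q ∘ ρCtx⁻¹ Γ)
          ≈ wpT τT (SPS M) (uncurry (Q ∘ ρ⁻¹ t)))
       ∧ ((gΓ : AllGround Γ) (gt : Ground t) →
          uncurry (wpS (τS τT) M Q)
            ≈ cast (cong (_× Y) (ctxGroundEq gΓ)) refl
                (wpT τT (SPS M) (cast (cong (_× Y) (sym (groundEq gt))) refl (uncurry Q))))
theorem5p5 C T Y Sig 𝒜S Ω alg M Q = wp-simulation τ M Q , wp-simulation-ground τ M Q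
  where
    open SPSCorrectness C T Y Sig 𝒜S
    τ = EMAlgebra.τ alg
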